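{- Let $(A_n,B_n)_{n\ge2}$ be the twin Seidel matrix sequence, $B_n=(b_n(m,k))$. Then, as formal power series in $x,y,z$, $$\sum b_{2n}(m,k)\frac{x^{m-1}}{(m-1)!}\frac{y^{k-m-1}}{(k-m-1)!}\frac{z^{2n-1-k}}{(2n-1-k)!}=\frac{\sin x\,\cos z}{\cos^2(x+y+z)},$$ the sum being over all integers $n\ge1$, $m,k$ with $2\le m+1\le k\le 2n-1$, and $$\sum b_{2n}(m,k)\frac{x^{2n-m-1}}{(2n-m-1)!}\frac{y^{m-k-1}}{(m-k-1)!}\frac{z^{k-1}}{(k-1)!}=\frac{\cos(x+y)\,\sin(y+z)}{\cos^2(x+y+z)},$$ the sum being over all integers $n\ge1$, $m,k$ with $2\le k+1\le m\le 2n-1$.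
   Context: Twin Seidel matrix sequence: the unique sequence of square matrices $A_n=(a_n(m,k))_{1\le m,k\le n}$, $B_n=(b_n(m,k))_{1\le m,k\le n}$ ($n\ge2$) with nonnegative integer entries satisfying, with $a_n(m,\bullet)=\sum_k a_n(m,k)$, $a_n(\bullet,k)=\sum_m a_n(m,k)$ and similarly for $b$: (TS1) all diagonal entries are $0$, except $a_2(1,1)=1$; (TS2) for $n\ge3$: $a_n(m,n)=b_n(m,n)=0$ for all $m$, $a_n(n,k)=b_n(1,k)=0$ for all $k$, and $b_n(n,1)=0$; (TS3) $A_2=\begin{pmatrix}1&0\\0&0\end{pmatrix}$, $B_2=\begin{pmatrix}0&0\\1&0\end{pmatrix}$; (TS4) for $n\ge3$: $b_n(n,k)=a_{n-1}(\bullet,k-1)$ for $2\le k\le n-1$; $b_n(n-1,k)=a_{n-1}(\bullet,k)$ for $1\le k\le n-2$; $b_n(m+1,k)-b_n(m,k)=a_{n-1}(m,k)$ for $2\le k+1\le m\le n-2$; $b_n(m+1,k)-b_n(m,k)=a_{n-1}(m,k-1)$ for $3\le m+2\le k\le n-1$; (TS5) for $n\ge3$: $a_n(1,k)=b_{n-1}(\bullet,k-1)$ for $2\le k\le n-1$; $a_n(m+1,k)-a_n(m,k)=-b_{n-1}(m,k-1)$ for $3\le m+2\le k\le n-1$; $a_n(m+1,k)-a_n(m,k)=-b_{n-1}(m,k)$ for $2\le k+1\le m\le n-1$. -}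

module Defs where

open import Data.Nat using (ℕ; zero; suc; _≤_; _<_; _≡ᵇ_; _∸_; _!)
import Data.Nat as N
open import Data.Nat.Properties using (_!≢0)
open import Data.Bool using (Bool; true; false; if_then_else_; _∧_)
open import Data.Integer using (ℤ; +_)
open import Data.Rational using (ℚ; 0ℚ; 1ℚ; _+_; _*_; -_; _/_)
import Data.Rational as Q
open import Data.Product using (_×_)
open import Relation.Binary.PropositionalEquality using (_≡_; _≢_)
open import Relation.Nullary using (¬_)

-- A matrix sequence is a function  A : ℕ → ℕ → ℕ → ℕ  with  A n m k = a_n(m,k),
-- meaningful for n ≥ 2 and 1 ≤ m,k ≤ n (values outside this range are ignored).

MatSeq : Set
MatSeq = ℕ → ℕ → ℕ → ℕ

Σ₁ : ℕ → (ℕ → ℕ) → ℕ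
Σ₁ zero    f = 0
Σ₁ (suc n) f = Σ₁ n f N.+ f (suc n)

rowSum : MatSeq → ℕ → ℕ → ℕ
rowSum A n m = Σ₁ n (λ k → A n m k)

colSum : MatSeq → ℕ → ℕ → ℕ
colSum A n k = Σ₁ n (λ m → A n m k)

record TwinSeidel (A B : MatSeq) : Set where
  field
    ts1-a  : ∀ n m → 2 ≤ n → 1 ≤ m → m ≤ n → ¬ (n ≡ 2 × m ≡ 1) → A n m m ≡ 0
    ts1-b  : ∀ n m → 2 ≤ n → 1 ≤ m → m ≤ n → B n m m ≡ 0
    ts2-an : ∀ n m → 3 ≤ n → 1 ≤ m → m ≤ n → A n m n ≡ 0
    ts2-bn : ∀ n m → 3 ≤ n → 1 ≤ m → m ≤ n → B n m n ≡ 0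
    ts2-a  : ∀ n k → 3 ≤ n → 1 ≤ k → k ≤ n → A n n k ≡ 0
    ts2-b  : ∀ n k → 3 ≤ n → 1 ≤ k → k ≤ n → B n 1 k ≡ 0
    ts2-b1 : ∀ n → 3 ≤ n → B n n 1 ≡ 0
    ts3-a11 : A 2 1 1 ≡ 1
    ts3-a12 : A 2 1 2 ≡ 0
    ts3-a21 : A 2 2 1 ≡ 0
    ts3-a22 : A 2 2 2 ≡ 0
    ts3-b11 : B 2 1 1 ≡ 0
    ts3-b12 : B 2 1 2 ≡ 0
    ts3-b21 : B 2 2 1 ≡ 1
    ts3-b22 : B 2 2 2 ≡ 0
    ts4-1 : ∀ n k → 3 ≤ n → 2 ≤ k → k ≤ n ∸ 1 →
            B n n k ≡ colSum A (n ∸ 1) (k ∸ 1)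
    ts4-2 : ∀ n k → 3 ≤ n → 1 ≤ k → k ≤ n ∸ 2 →
            B n (n ∸ 1) k ≡ colSum A (n ∸ 1) k
    ts4-3 : ∀ n m k → 3 ≤ n → 2 ≤ suc k → suc k ≤ m → m ≤ n ∸ 2 →
            B n (suc m) k ≡ B n m k N.+ A (n ∸ 1) m k
    ts4-4 : ∀ n m k → 3 ≤ n → 3 ≤ m N.+ 2 → m N.+ 2 ≤ k → k ≤ n ∸ 1 →
            B n (suc m) k ≡ B n m k N.+ A (n ∸ 1) m (k ∸ 1)
    -- (TS5)   (a(m+1,k) - a(m,k) = -b(..)  is written  a(m,k) = a(m+1,k) + b(..))
    ts5-1 : ∀ n k → 3 ≤ n → 2 ≤ k → k ≤ n ∸ 1 →
            A n 1 k ≡ colSum B (n ∸ 1) (k ∸ 1)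
    ts5-2 : ∀ n m k → 3 ≤ n → 3 ≤ m N.+ 2 → m N.+ 2 ≤ k → k ≤ n ∸ 1 →
            A n m k ≡ A n (suc m) k N.+ B (n ∸ 1) m (k ∸ 1)
    ts5-3 : ∀ n m k → 3 ≤ n → 2 ≤ suc k → suc k ≤ m → m ≤ n ∸ 1 →
            A n m k ≡ A n (suc m) k N.+ B (n ∸ 1) m k

-- Formal power series with rational coefficients.
-- PS1 : one variable u,  f ↦ Σ f(n) uⁿ.
-- PS3 : three variables x,y,z,  F ↦ Σ F(a,b,c) xᵃ yᵇ zᶜ  (ordinary coefficients).

PS1 : Set
PS1 = ℕ → ℚ

PS3 : Set
PS3 = ℕ → ℕ → ℕ → ℚ

Σ₀ : ℕ → (ℕ → ℚ) → ℚ
Σ₀ zero    f = f 0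
Σ₀ (suc n) f = Σ₀ n f + f (suc n)

invFact : ℕ → ℚ
invFact n = (+ 1 / (n !)) {{n !≢0}}

fromℕ : ℕ → ℚ
fromℕ n = + n / 1

sgn : ℕ → ℚ
sgn zero    = 1ℚ
sgn (suc k) = - sgn k

isEven : ℕ → Bool
isEven zero          = true
isEven (suc zero)    = false
isEven (suc (suc n)) = isEven n

-- sin u = Σ_k (-1)^k u^(2k+1)/(2k+1)! ,  cos u = Σ_k (-1)^k u^(2k)/(2k)!
sinS : PS1
sinS n = if isEven n then 0ℚ else sgn (n N./ 2) * invFact n

cosS : PS1
cosS n = if isEven n then sgn (n N./ 2) * invFact n else 0ℚ

_·₁_ : PS1 → PS1 → PS1
(f ·₁ g) n = Σ₀ n (λ i → f i * g (n ∸ i))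

-- Multiplicative inverse of a one-variable series g with constant term g 0 = 1:
-- h 0 = 1,  h n = - Σ_{i=1}^{n} g i * h (n - i).
-- recipTab g n j is h j for j ≤ n.
recipTab : PS1 → ℕ → ℕ → ℚ
recipTab g zero    j = 1ℚ
recipTab g (suc n) j =
  if j N.≤ᵇ n then recipTab g n j
  else - Σ₀ n (λ i → g (suc i) * recipTab g n (n ∸ i))

recip₁ : PS1 → PS1
recip₁ g n = recipTab g n n

_·₃_ : PS3 → PS3 → PS3
(F ·₃ G) a b c =
  Σ₀ a (λ i → Σ₀ b (λ j → Σ₀ c (λ l → F i j l * G (a ∸ i) (b ∸ j) (c ∸ l))))

-- Substitutions of a one-variable series f(u):
-- coefficient of xᵃyᵇzᶜ in f(x+y+z) is f(a+b+c)·(a+b+c)!/(a!b!c!), etc.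
atX : PS1 → PS3
atX f a b c = if (b ≡ᵇ 0) ∧ (c ≡ᵇ 0) then f a else 0ℚ

atZ : PS1 → PS3
atZ f a b c = if (a ≡ᵇ 0) ∧ (b ≡ᵇ 0) then f c else 0ℚ

atXY : PS1 → PS3
atXY f a b c =
  if c ≡ᵇ 0 then f (a N.+ b) * (fromℕ ((a N.+ b) !) * (invFact a * invFact b)) else 0ℚ

atYZ : PS1 → PS3
atYZ f a b c =
  if a ≡ᵇ 0 then f (b N.+ c) * (fromℕ ((b N.+ c) !) * (invFact b * invFact c)) else 0ℚ

atXYZ : PS1 → PS3
atXYZ f a b c =
  f (a N.+ b N.+ c) * (fromℕ ((a N.+ b N.+ c) !) * (invFact a * invFact b * invFact c))

secSq : PS1
secSq = recip₁ (cosS ·₁ cosS)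

rhs₁ : PS3
rhs₁ = (atX sinS ·₃ atZ cosS) ·₃ atXYZ secSq

rhs₂ : PS3
rhs₂ = (atXY cosS ·₃ atYZ sinS) ·₃ atXYZ secSq

-- First sum: the term for (n,m,k), 2 ≤ m+1 ≤ k ≤ 2n-1, is
--   b_{2n}(m,k) x^(m-1) y^(k-m-1) z^(2n-1-k) / ((m-1)!(k-m-1)!(2n-1-k)!);
-- the monomial xᵃyᵇzᶜ arises iff a+b+c+3 = 2n is even, with m = a+1, k = a+b+2.
lhs₁ : MatSeq → PS3
lhs₁ B a b c =
  if isEven (a N.+ b N.+ c N.+ 3)
  then fromℕ (B (a N.+ b N.+ c N.+ 3) (a N.+ 1) (a N.+ b N.+ 2))
         * (invFact a * invFact b * invFact c)
  else 0ℚ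

-- Second sum: term for (n,m,k), 2 ≤ k+1 ≤ m ≤ 2n-1, is
--   b_{2n}(m,k) x^(2n-m-1) y^(m-k-1) z^(k-1) / ((2n-m-1)!(m-k-1)!(k-1)!);
-- xᵃyᵇzᶜ arises iff a+b+c+3 = 2n is even, with k = c+1, m = b+c+2.
lhs₂ : MatSeq → PS3
lhs₂ B a b c =
  if isEven (a N.+ b N.+ c N.+ 3)
  then fromℕ (B (a N.+ b N.+ c N.+ 3) (b N.+ c N.+ 2) (c N.+ 1))
         * (invFact a * invFact b * invFact c)
  else 0ℚ

_≈₃_ : PS3 → PS3 → Set
F ≈₃ G = ∀ a b c → F a b c ≡ G a b c

-- Write S₁, S₂ for the two right-hand sides and C₁ = cos x cos z / cos²(x+y+z),
-- C₂ = cos(x+y) cos(y+z) / cos²(x+y+z) for their companions.  Since sin′ = cos and cos′ = −sin,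
-- the Leibniz rule gives
--   ∂x S₁ = ∂y S₁ + C₁,   ∂y C₁ = ∂x C₁ + S₁,   ∂y S₂ = ∂x S₂ + C₂,   ∂x C₂ = ∂y C₂ + S₂,
-- which, read on the coefficients of xᵃ yᵇ zᶜ / (a! b! c!), are the recurrences (TS4) and (TS5)
-- expressing B_N through A_{N-1} and A_N through B_{N-1}, with S₁, S₂ for the entries of B above and
-- below the diagonal and C₁, C₂ for those of A.  The boundary entries match as well: S₁ vanishes at
-- x = 0 like the first row of B; summing columns shows b_N(k+1,k) = b_N(k,k+1) and
-- a_N(k,k+1) = a_N(k+1,k), matching the x ↔ z symmetry of S₂ and C₂ at y = 0; and the last row of
-- B_N, a shifted copy of row N−1, matches ∂z C₂ = S₂ at x = 0, i.e. (sec u)′ = sin u sec² u.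
-- A simultaneous induction on N then identifies the entries of B_{2n} with the coefficients of S₁
-- and S₂, and the remaining coefficients vanish because S₁ and S₂ are odd.

module Submission where

open import Defs
open import Data.Product using (_×_; _,_)

module Series where

  open import Data.Nat as N using (ℕ; zero; suc; _∸_; _!; _≤_; _<_; z≤n; s≤s)
  import Data.Nat.Properties as NP
  open import Data.Nat.DivMod using (m/n≡1+[m∸n]/n)
  open import Data.Bool using (Bool; true; false; if_then_else_; not)
  open import Data.Bool.Properties using (T-≡; not-injective)
  open import Function.Bundles using (module Equivalence)
  open import Data.Sum using (_⊎_; inj₁; inj₂)
  import Data.Integer as Z
  import Data.Integer.Properties as ZP
  open import Data.Rational using (ℚ; 0ℚ; 1ℚ; _+_; _*_; -_; _/_; toℚᵘ)
  open import Data.Rational.Properties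
  import Data.Rational.Unnormalised as U
  import Data.Rational.Unnormalised.Properties as UP
  open import Relation.Binary.PropositionalEquality
  open import Data.Rational.Solver
  open +-*-Solver
  import Data.Nat.Solver as NSolver
  open NSolver.+-*-Solver using ()
    renaming (solve to solveℕ; _:+_ to _⊹_; _:=_ to _≐_)

  open ≡-Reasoning

  fromℕ≃mkℚᵘ : ∀ n → toℚᵘ (fromℕ n) U.≃ U.mkℚᵘ (Z.+ n) 0
  fromℕ≃mkℚᵘ n = toℚᵘ-fromℚᵘ (U.mkℚᵘ (Z.+ n) 0)

  fromℕ-+ : ∀ m n → fromℕ (m N.+ n) ≡ fromℕ m + fromℕ n
  fromℕ-+ m n = toℚᵘ-injective (UP.≃-trans (fromℕ≃mkℚᵘ (m N.+ n)) (UP.≃-trans (U.*≡* eq)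
    (UP.≃-sym (UP.≃-trans (toℚᵘ-homo-+ (fromℕ m) (fromℕ n))
                          (UP.+-cong (fromℕ≃mkℚᵘ m) (fromℕ≃mkℚᵘ n))))))
    where
    eq : Z.+ (m N.+ n) Z.* Z.+ 1 ≡ (Z.+ m Z.* Z.+ 1 Z.+ Z.+ n Z.* Z.+ 1) Z.* Z.+ 1
    eq = trans (ZP.*-identityʳ (Z.+ (m N.+ n))) (sym (trans (ZP.*-identityʳ _)
           (cong₂ Z._+_ (ZP.*-identityʳ (Z.+ m)) (ZP.*-identityʳ (Z.+ n)))))

  fromℕ-* : ∀ m n → fromℕ (m N.* n) ≡ fromℕ m * fromℕ n
  fromℕ-* m n = toℚᵘ-injective (UP.≃-trans (fromℕ≃mkℚᵘ (m N.* n)) (UP.≃-trans (U.*≡* eq)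
    (UP.≃-sym (UP.≃-trans (toℚᵘ-homo-* (fromℕ m) (fromℕ n))
                          (UP.*-cong (fromℕ≃mkℚᵘ m) (fromℕ≃mkℚᵘ n))))))
    where
    eq : Z.+ (m N.* n) Z.* Z.+ 1 ≡ (Z.+ m Z.* Z.+ n) Z.* Z.+ 1
    eq = trans (ZP.*-identityʳ _) (trans (ZP.pos-* m n) (sym (ZP.*-identityʳ _)))

  fromℕ*1/n≡1 : ∀ n .{{_ : N.NonZero n}} → fromℕ n * (Z.+ 1 / n) ≡ 1ℚ
  fromℕ*1/n≡1 (suc n) = toℚᵘ-injective (UP.≃-trans (toℚᵘ-homo-* (fromℕ (suc n)) (Z.+ 1 / suc n))
    (UP.≃-trans (UP.*-cong (fromℕ≃mkℚᵘ (suc n)) (toℚᵘ-fromℚᵘ (U.mkℚᵘ (Z.+ 1) n))) (U.*≡* eq)))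
    where
    eq : Z.+ (suc n N.* 1) Z.* Z.+ 1 ≡ Z.+ 1 Z.* Z.+ (1 N.* suc n)
    eq = trans (ZP.*-identityʳ _) (sym (trans (ZP.*-identityˡ _)
           (cong Z.+_ (trans (NP.*-identityˡ (suc n)) (sym (NP.*-identityʳ (suc n)))))))

  fromℕ[n!]*invFact≡1 : ∀ n → fromℕ (n !) * invFact n ≡ 1ℚ
  fromℕ[n!]*invFact≡1 n = fromℕ*1/n≡1 (n !) {{n NP.!≢0}}

  fromℕ[1+n]*invFact[1+n]≡invFact : ∀ n → fromℕ (suc n) * invFact (suc n) ≡ invFact n
  fromℕ[1+n]*invFact[1+n]≡invFact n = begin
    s * invFact (suc n)                              ≡⟨ solve 2 (λ x y → x :* y := x :* y :* con 1ℚ) refl s _ ⟩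
    s * invFact (suc n) * 1ℚ                         ≡⟨ cong (s * invFact (suc n) *_) (sym (fromℕ[n!]*invFact≡1 n)) ⟩
    s * invFact (suc n) * (fromℕ (n !) * invFact n)
      ≡⟨ solve 4 (λ s i f j → s :* i :* (f :* j) := (s :* f :* i) :* j) refl s (invFact (suc n)) (fromℕ (n !)) (invFact n) ⟩
    s * fromℕ (n !) * invFact (suc n) * invFact n    ≡⟨ cong (λ x → x * invFact (suc n) * invFact n) (sym (fromℕ-* (suc n) (n !))) ⟩
    fromℕ (suc n !) * invFact (suc n) * invFact n    ≡⟨ cong (_* invFact n) (fromℕ[n!]*invFact≡1 (suc n)) ⟩
    1ℚ * invFact n                                   ≡⟨ *-identityˡ _ ⟩
    invFact n                                        ∎
    where s = fromℕ (suc n)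

  *-cancelˡ-fromℕ-suc : ∀ n {x y} → fromℕ (suc n) * x ≡ fromℕ (suc n) * y → x ≡ y
  *-cancelˡ-fromℕ-suc n {x} {y} p = begin
    x                  ≡⟨ solve 1 (λ x → x := con 1ℚ :* x) refl x ⟩
    1ℚ * x             ≡⟨ cong (_* x) (sym k*i≡1) ⟩
    k * i * x          ≡⟨ solve 3 (λ k i x → k :* i :* x := i :* (k :* x)) refl k i x ⟩
    i * (k * x)        ≡⟨ cong (i *_) p ⟩
    i * (k * y)        ≡⟨ solve 3 (λ k i y → i :* (k :* y) := k :* i :* y) refl k i y ⟩
    k * i * y          ≡⟨ cong (_* y) k*i≡1 ⟩
    1ℚ * y             ≡⟨ *-identityˡ y ⟩
    y                  ∎
    where
    k = fromℕ (suc n)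
    i = Z.+ 1 / suc n
    k*i≡1 : k * i ≡ 1ℚ
    k*i≡1 = fromℕ*1/n≡1 (suc n)

  Σ₀-cong : ∀ n {f g : ℕ → ℚ} → (∀ i → i ≤ n → f i ≡ g i) → Σ₀ n f ≡ Σ₀ n g
  Σ₀-cong zero    h = h 0 z≤n
  Σ₀-cong (suc n) h = cong₂ _+_ (Σ₀-cong n (λ i i≤n → h i (NP.m≤n⇒m≤1+n i≤n))) (h (suc n) NP.≤-refl)

  Σ₀-ext : ∀ n {f g : ℕ → ℚ} → (∀ i → f i ≡ g i) → Σ₀ n f ≡ Σ₀ n g
  Σ₀-ext n h = Σ₀-cong n (λ i _ → h i)

  Σ₀-+ : ∀ n (f g : ℕ → ℚ) → Σ₀ n (λ i → f i + g i) ≡ Σ₀ n f + Σ₀ n g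
  Σ₀-+ zero    f g = refl
  Σ₀-+ (suc n) f g = trans (cong (_+ (f (suc n) + g (suc n))) (Σ₀-+ n f g))
    (solve 4 (λ a b c d → (a :+ b) :+ (c :+ d) := (a :+ c) :+ (b :+ d)) refl (Σ₀ n f) (Σ₀ n g) (f (suc n)) (g (suc n)))

  *-distribˡ-Σ₀ : ∀ n c (f : ℕ → ℚ) → c * Σ₀ n f ≡ Σ₀ n (λ i → c * f i)
  *-distribˡ-Σ₀ zero    c f = refl
  *-distribˡ-Σ₀ (suc n) c f = trans (*-distribˡ-+ c (Σ₀ n f) (f (suc n))) (cong (_+ c * f (suc n)) (*-distribˡ-Σ₀ n c f))

  neg-distrib-Σ₀ : ∀ n (f : ℕ → ℚ) → - Σ₀ n f ≡ Σ₀ n (λ i → - f i)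
  neg-distrib-Σ₀ zero    f = refl
  neg-distrib-Σ₀ (suc n) f = trans (neg-distrib-+ (Σ₀ n f) (f (suc n))) (cong (_+ - f (suc n)) (neg-distrib-Σ₀ n f))

  Σ₀-zero : ∀ n {f : ℕ → ℚ} → (∀ i → i ≤ n → f i ≡ 0ℚ) → Σ₀ n f ≡ 0ℚ
  Σ₀-zero n {f} h = trans (Σ₀-cong n h) (Σ₀-const-0 n)
    where
    Σ₀-const-0 : ∀ n → Σ₀ n (λ _ → 0ℚ) ≡ 0ℚ
    Σ₀-const-0 zero    = refl
    Σ₀-const-0 (suc n) = trans (+-identityʳ _) (Σ₀-const-0 n)

  Σ₀-suc-head : ∀ n (f : ℕ → ℚ) → Σ₀ (suc n) f ≡ f 0 + Σ₀ n (λ i → f (suc i))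
  Σ₀-suc-head zero    f = refl
  Σ₀-suc-head (suc n) f = trans (cong (_+ f (suc (suc n))) (Σ₀-suc-head n f)) (+-assoc (f 0) _ _)

  Σ₀-only-head : ∀ n {f : ℕ → ℚ} → (∀ i → i < n → f (suc i) ≡ 0ℚ) → Σ₀ n f ≡ f 0
  Σ₀-only-head zero    h = refl
  Σ₀-only-head (suc n) {f} h = trans (Σ₀-suc-head n f)
    (trans (cong (f 0 +_) (Σ₀-zero n (λ i i≤n → h i (s≤s i≤n)))) (+-identityʳ _))

  Σ₀-only-last : ∀ n {f : ℕ → ℚ} → (∀ i → i < n → f i ≡ 0ℚ) → Σ₀ n f ≡ f n
  Σ₀-only-last zero    h = refl
  Σ₀-only-last (suc n) {f} h = trans (cong (_+ f (suc n)) (Σ₀-zero n (λ i i≤n → h i (s≤s i≤n)))) (+-identityˡ _)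

  Σ₀-comm : ∀ n m (f : ℕ → ℕ → ℚ) → Σ₀ n (λ i → Σ₀ m (f i)) ≡ Σ₀ m (λ j → Σ₀ n (λ i → f i j))
  Σ₀-comm zero    m f = refl
  Σ₀-comm (suc n) m f = trans (cong (_+ Σ₀ m (f (suc n))) (Σ₀-comm n m f))
    (sym (Σ₀-+ m (λ j → Σ₀ n (λ i → f i j)) (f (suc n))))

  Σ₀-reverse : ∀ n (f : ℕ → ℚ) → Σ₀ n f ≡ Σ₀ n (λ i → f (n ∸ i))
  Σ₀-reverse zero    f = refl
  Σ₀-reverse (suc n) f = trans (cong (_+ f (suc n)) (Σ₀-reverse n f))
    (trans (+-comm _ (f (suc n))) (sym (Σ₀-suc-head n (λ i → f (suc n ∸ i)))))

  -- The discrete Leibniz rule: split the factor n+1 of the term φ i j as i + j.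
  leibniz-Σ₀ : ∀ n (φ : ℕ → ℕ → ℚ) →
    fromℕ (suc n) * Σ₀ (suc n) (λ i → φ i (suc n ∸ i))
    ≡ Σ₀ n (λ i → fromℕ (suc i) * φ (suc i) (n ∸ i)) + Σ₀ n (λ i → fromℕ (suc (n ∸ i)) * φ i (suc (n ∸ i)))
  leibniz-Σ₀ n φ = begin
    fromℕ (suc n) * Σ₀ (suc n) (λ i → φ i (suc n ∸ i))
      ≡⟨ *-distribˡ-Σ₀ (suc n) (fromℕ (suc n)) _ ⟩
    Σ₀ (suc n) (λ i → fromℕ (suc n) * φ i (suc n ∸ i))
      ≡⟨ Σ₀-cong (suc n) split ⟩
    Σ₀ (suc n) (λ i → fromℕ i * φ i (suc n ∸ i) + fromℕ (suc n ∸ i) * φ i (suc n ∸ i))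
      ≡⟨ Σ₀-+ (suc n) _ _ ⟩
    Σ₀ (suc n) (λ i → fromℕ i * φ i (suc n ∸ i)) + Σ₀ (suc n) (λ i → fromℕ (suc n ∸ i) * φ i (suc n ∸ i))
      ≡⟨ cong₂ _+_ dropFirst dropLast ⟩
    Σ₀ n (λ i → fromℕ (suc i) * φ (suc i) (n ∸ i)) + Σ₀ n (λ i → fromℕ (suc (n ∸ i)) * φ i (suc (n ∸ i))) ∎
    where
    split : ∀ i → i ≤ suc n →
      fromℕ (suc n) * φ i (suc n ∸ i) ≡ fromℕ i * φ i (suc n ∸ i) + fromℕ (suc n ∸ i) * φ i (suc n ∸ i)
    split i i≤ = trans (cong (λ x → fromℕ x * φ i (suc n ∸ i)) (sym (NP.m+[n∸m]≡n i≤)))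
      (trans (cong (_* φ i (suc n ∸ i)) (fromℕ-+ i (suc n ∸ i))) (*-distribʳ-+ _ (fromℕ i) _))
    dropFirst : Σ₀ (suc n) (λ i → fromℕ i * φ i (suc n ∸ i)) ≡ Σ₀ n (λ i → fromℕ (suc i) * φ (suc i) (n ∸ i))
    dropFirst = trans (Σ₀-suc-head n _)
      (trans (cong (_+ Σ₀ n (λ i → fromℕ (suc i) * φ (suc i) (n ∸ i))) (*-zeroˡ (φ 0 (suc n)))) (+-identityˡ _))
    dropLast : Σ₀ (suc n) (λ i → fromℕ (suc n ∸ i) * φ i (suc n ∸ i))
             ≡ Σ₀ n (λ i → fromℕ (suc (n ∸ i)) * φ i (suc (n ∸ i)))
    dropLast = trans (cong (Σ₀ n (λ i → fromℕ (suc n ∸ i) * φ i (suc n ∸ i)) +_)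
                           (trans (cong (λ x → fromℕ x * φ (suc n) x) (NP.n∸n≡0 n)) (*-zeroˡ (φ (suc n) 0))))
      (trans (+-identityʳ _) (Σ₀-cong n (λ i i≤ → cong (λ x → fromℕ x * φ i x) (NP.+-∸-assoc 1 i≤))))

  deriv : PS1 → PS1
  deriv f n = fromℕ (suc n) * f (suc n)

  one₁ : PS1
  one₁ zero    = 1ℚ
  one₁ (suc n) = 0ℚ

  ·₁-cong : ∀ {f f′ g g′} → (∀ n → f n ≡ f′ n) → (∀ n → g n ≡ g′ n) → ∀ n → (f ·₁ g) n ≡ (f′ ·₁ g′) n
  ·₁-cong p q n = Σ₀-ext n (λ i → cong₂ _*_ (p i) (q (n ∸ i)))

  ·₁-distribʳ-+ : ∀ f g h n → ((λ i → f i + g i) ·₁ h) n ≡ (f ·₁ h) n + (g ·₁ h) n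
  ·₁-distribʳ-+ f g h n = trans (Σ₀-ext n (λ i → *-distribʳ-+ (h (n ∸ i)) (f i) (g i))) (Σ₀-+ n _ _)

  ·₁-distribˡ-+ : ∀ h f g n → (h ·₁ (λ i → f i + g i)) n ≡ (h ·₁ f) n + (h ·₁ g) n
  ·₁-distribˡ-+ h f g n = trans (Σ₀-ext n (λ i → *-distribˡ-+ (h i) (f (n ∸ i)) (g (n ∸ i)))) (Σ₀-+ n _ _)

  neg-distribˡ-·₁ : ∀ f g n → ((λ i → - f i) ·₁ g) n ≡ - (f ·₁ g) n
  neg-distribˡ-·₁ f g n = trans (Σ₀-ext n (λ i → sym (neg-distribˡ-* (f i) (g (n ∸ i))))) (sym (neg-distrib-Σ₀ n _))

  neg-distribʳ-·₁ : ∀ f g n → (f ·₁ (λ i → - g i)) n ≡ - (f ·₁ g) n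
  neg-distribʳ-·₁ f g n = trans (Σ₀-ext n (λ i → sym (neg-distribʳ-* (f i) (g (n ∸ i))))) (sym (neg-distrib-Σ₀ n _))

  ·₁-comm : ∀ f g n → (f ·₁ g) n ≡ (g ·₁ f) n
  ·₁-comm f g n = trans (Σ₀-reverse n _) (Σ₀-cong n (λ i i≤ →
    trans (cong (λ x → f (n ∸ i) * g x) (NP.m∸[m∸n]≡n i≤)) (*-comm (f (n ∸ i)) (g i))))

  deriv-·₁ : ∀ f g n → deriv (f ·₁ g) n ≡ (deriv f ·₁ g) n + (f ·₁ deriv g) n
  deriv-·₁ f g n = trans (leibniz-Σ₀ n (λ i j → f i * g j)) (cong₂ _+_
    (Σ₀-ext n (λ i → sym (*-assoc (fromℕ (suc i)) (f (suc i)) (g (n ∸ i)))))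
    (Σ₀-ext n (λ i → solve 3 (λ k x y → k :* (x :* y) := x :* (k :* y)) refl (fromℕ (suc (n ∸ i))) (f i) (g (suc (n ∸ i))))))

  -- Both sides have the same constant term and, by the Leibniz rule and induction, the same derivative.
  ·₁-assoc : ∀ n f g h → ((f ·₁ g) ·₁ h) n ≡ (f ·₁ (g ·₁ h)) n
  ·₁-assoc zero    f g h = *-assoc (f 0) (g 0) (h 0)
  ·₁-assoc (suc n) f g h = *-cancelˡ-fromℕ-suc n (begin
    deriv ((f ·₁ g) ·₁ h) n
      ≡⟨ deriv-·₁ (f ·₁ g) h n ⟩
    (deriv (f ·₁ g) ·₁ h) n + ((f ·₁ g) ·₁ deriv h) n
      ≡⟨ cong (_+ ((f ·₁ g) ·₁ deriv h) n)
           (trans (·₁-cong {g = h} (deriv-·₁ f g) (λ _ → refl) n) (·₁-distribʳ-+ (deriv f ·₁ g) (f ·₁ deriv g) h n)) ⟩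
    ((deriv f ·₁ g) ·₁ h) n + ((f ·₁ deriv g) ·₁ h) n + ((f ·₁ g) ·₁ deriv h) n
      ≡⟨ cong₂ _+_ (cong₂ _+_ (·₁-assoc n (deriv f) g h) (·₁-assoc n f (deriv g) h)) (·₁-assoc n f g (deriv h)) ⟩
    (deriv f ·₁ (g ·₁ h)) n + (f ·₁ (deriv g ·₁ h)) n + (f ·₁ (g ·₁ deriv h)) n
      ≡⟨ +-assoc ((deriv f ·₁ (g ·₁ h)) n) _ _ ⟩
    (deriv f ·₁ (g ·₁ h)) n + ((f ·₁ (deriv g ·₁ h)) n + (f ·₁ (g ·₁ deriv h)) n)
      ≡⟨ cong ((deriv f ·₁ (g ·₁ h)) n +_)
           (sym (trans (·₁-cong {f = f} (λ _ → refl) (deriv-·₁ g h) n) (·₁-distribˡ-+ f (deriv g ·₁ h) (g ·₁ deriv h) n))) ⟩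
    (deriv f ·₁ (g ·₁ h)) n + (f ·₁ deriv (g ·₁ h)) n
      ≡⟨ sym (deriv-·₁ f (g ·₁ h) n) ⟩
    deriv (f ·₁ (g ·₁ h)) n ∎)

  -- The coefficients of u are determined one by one: (c · u) (m+1) = u (m+1) + (terms in u 0 … u m).
  ·₁-unit-zero : ∀ c u → c 0 ≡ 1ℚ → (∀ n → (c ·₁ u) n ≡ 0ℚ) → ∀ n → u n ≡ 0ℚ
  ·₁-unit-zero c u c0≡1 cu≡0 n = go n n NP.≤-refl
    where
    go : ∀ N m → m ≤ N → u m ≡ 0ℚ
    go N zero _ = trans (sym (trans (cong (_* u 0) c0≡1) (*-identityˡ (u 0)))) (cu≡0 0)
    go (suc N) (suc m) (s≤s m≤N) = begin
      u (suc m)                                               ≡⟨ sym (*-identityˡ _) ⟩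
      1ℚ * u (suc m)                                          ≡⟨ cong (_* u (suc m)) (sym c0≡1) ⟩
      c 0 * u (suc m)                                         ≡⟨ sym (+-identityʳ _) ⟩
      c 0 * u (suc m) + 0ℚ                                    ≡⟨ cong (c 0 * u (suc m) +_) (sym (Σ₀-zero m lower≡0)) ⟩
      c 0 * u (suc m) + Σ₀ m (λ i → c (suc i) * u (m ∸ i))    ≡⟨ sym (Σ₀-suc-head m _) ⟩
      (c ·₁ u) (suc m)                                        ≡⟨ cu≡0 (suc m) ⟩
      0ℚ                                                      ∎
      where
      lower≡0 : ∀ i → i ≤ m → c (suc i) * u (m ∸ i) ≡ 0ℚ
      lower≡0 i _ = trans (cong (c (suc i) *_) (go N (m ∸ i) (NP.≤-trans (NP.m∸n≤m m i) m≤N))) (*-zeroʳ (c (suc i)))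

  ≤⇒≤ᵇ≡true : ∀ {m n} → m ≤ n → (m N.≤ᵇ n) ≡ true
  ≤⇒≤ᵇ≡true m≤n = Equivalence.to T-≡ (NP.≤⇒≤ᵇ m≤n)

  1+n≤ᵇn≡false : ∀ n → (suc n N.≤ᵇ n) ≡ false
  1+n≤ᵇn≡false zero    = refl
  1+n≤ᵇn≡false (suc n) = 1+n≤ᵇn≡false n

  recipTab≡recip₁ : ∀ g n j → j ≤ n → recipTab g n j ≡ recip₁ g j
  recipTab≡recip₁ g zero    zero z≤n = refl
  recipTab≡recip₁ g (suc n) j j≤1+n with NP.m≤n⇒m<n∨m≡n j≤1+n
  ... | inj₂ refl = refl
  ... | inj₁ (s≤s j≤n) rewrite ≤⇒≤ᵇ≡true j≤n = recipTab≡recip₁ g n j j≤n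

  recip₁-suc : ∀ g n → recip₁ g (suc n) ≡ - Σ₀ n (λ i → g (suc i) * recip₁ g (n ∸ i))
  recip₁-suc g n rewrite 1+n≤ᵇn≡false n =
    cong -_ (Σ₀-ext n (λ i → cong (g (suc i) *_) (recipTab≡recip₁ g n (n ∸ i) (NP.m∸n≤m n i))))

  ·₁-recip₁ : ∀ g → g 0 ≡ 1ℚ → ∀ n → (g ·₁ recip₁ g) n ≡ one₁ n
  ·₁-recip₁ g g0≡1 zero    = cong (_* 1ℚ) g0≡1
  ·₁-recip₁ g g0≡1 (suc n) = begin
    Σ₀ (suc n) (λ i → g i * recip₁ g (suc n ∸ i))  ≡⟨ Σ₀-suc-head n _ ⟩
    g 0 * recip₁ g (suc n) + X                     ≡⟨ cong₂ (λ u v → u * v + X) g0≡1 (recip₁-suc g n) ⟩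
    1ℚ * - X + X                                   ≡⟨ solve 1 (λ x → con 1ℚ :* (:- x) :+ x := con 0ℚ) refl X ⟩
    0ℚ                                             ∎
    where X = Σ₀ n (λ i → g (suc i) * recip₁ g (n ∸ i))

  isEven-suc : ∀ n → isEven (suc n) ≡ not (isEven n)
  isEven-suc zero          = refl
  isEven-suc (suc zero)    = refl
  isEven-suc (suc (suc n)) = isEven-suc n

  [2+n]/2≡1+n/2 : ∀ n → suc (suc n) N./ 2 ≡ suc (n N./ 2)
  [2+n]/2≡1+n/2 n = m/n≡1+[m∸n]/n {suc (suc n)} {2} (s≤s (s≤s z≤n))

  even⇒[1+n]/2≡n/2 : ∀ n → isEven n ≡ true → suc n N./ 2 ≡ n N./ 2
  even⇒[1+n]/2≡n/2 zero          _ = refl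
  even⇒[1+n]/2≡n/2 (suc zero)    ()
  even⇒[1+n]/2≡n/2 (suc (suc n)) e =
    trans ([2+n]/2≡1+n/2 (suc n)) (trans (cong suc (even⇒[1+n]/2≡n/2 n e)) (sym ([2+n]/2≡1+n/2 n)))

  odd⇒[1+n]/2≡1+n/2 : ∀ n → isEven n ≡ false → suc n N./ 2 ≡ suc (n N./ 2)
  odd⇒[1+n]/2≡1+n/2 zero          ()
  odd⇒[1+n]/2≡1+n/2 (suc zero)    _ = refl
  odd⇒[1+n]/2≡1+n/2 (suc (suc n)) e =
    trans ([2+n]/2≡1+n/2 (suc n)) (trans (cong suc (odd⇒[1+n]/2≡1+n/2 n e)) (cong suc (sym ([2+n]/2≡1+n/2 n))))

  sinS[even]≡0 : ∀ n → isEven n ≡ true → sinS n ≡ 0ℚ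
  sinS[even]≡0 n e = cong (λ b → if b then 0ℚ else sgn (n N./ 2) * invFact n) e

  sinS[odd] : ∀ n → isEven n ≡ false → sinS n ≡ sgn (n N./ 2) * invFact n
  sinS[odd] n e = cong (λ b → if b then 0ℚ else sgn (n N./ 2) * invFact n) e

  cosS[even] : ∀ n → isEven n ≡ true → cosS n ≡ sgn (n N./ 2) * invFact n
  cosS[even] n e = cong (λ b → if b then sgn (n N./ 2) * invFact n else 0ℚ) e

  cosS[odd]≡0 : ∀ n → isEven n ≡ false → cosS n ≡ 0ℚ
  cosS[odd]≡0 n e = cong (λ b → if b then sgn (n N./ 2) * invFact n else 0ℚ) e

  fromℕ[1+n]*[s*invFact[1+n]]≡s*invFact : ∀ n s → fromℕ (suc n) * (s * invFact (suc n)) ≡ s * invFact n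
  fromℕ[1+n]*[s*invFact[1+n]]≡s*invFact n s =
    trans (solve 3 (λ k s i → k :* (s :* i) := s :* (k :* i)) refl (fromℕ (suc n)) s (invFact (suc n)))
          (cong (s *_) (fromℕ[1+n]*invFact[1+n]≡invFact n))

  deriv-sinS : ∀ n → deriv sinS n ≡ cosS n
  deriv-sinS n with isEven n in e
  ... | true = begin
    fromℕ (suc n) * sinS (suc n)                         ≡⟨ cong (fromℕ (suc n) *_) (sinS[odd] (suc n) suc-odd) ⟩
    fromℕ (suc n) * (sgn (suc n N./ 2) * invFact (suc n))
      ≡⟨ cong (λ h → fromℕ (suc n) * (sgn h * invFact (suc n))) (even⇒[1+n]/2≡n/2 n e) ⟩
    fromℕ (suc n) * (sgn (n N./ 2) * invFact (suc n))     ≡⟨ fromℕ[1+n]*[s*invFact[1+n]]≡s*invFact n (sgn (n N./ 2)) ⟩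
    sgn (n N./ 2) * invFact n                             ∎
    where suc-odd = trans (isEven-suc n) (cong not e)
  ... | false = trans (cong (fromℕ (suc n) *_) (sinS[even]≡0 (suc n) (trans (isEven-suc n) (cong not e)))) (*-zeroʳ (fromℕ (suc n)))

  deriv-cosS : ∀ n → deriv cosS n ≡ - sinS n
  deriv-cosS n with isEven n in e
  ... | true = trans (cong (fromℕ (suc n) *_) (cosS[odd]≡0 (suc n) (trans (isEven-suc n) (cong not e)))) (*-zeroʳ (fromℕ (suc n)))
  ... | false = begin
    fromℕ (suc n) * cosS (suc n)                            ≡⟨ cong (fromℕ (suc n) *_) (cosS[even] (suc n) suc-even) ⟩
    fromℕ (suc n) * (sgn (suc n N./ 2) * invFact (suc n))
      ≡⟨ cong (λ h → fromℕ (suc n) * (sgn h * invFact (suc n))) (odd⇒[1+n]/2≡1+n/2 n e) ⟩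
    fromℕ (suc n) * (- sgn (n N./ 2) * invFact (suc n))      ≡⟨ fromℕ[1+n]*[s*invFact[1+n]]≡s*invFact n (- sgn (n N./ 2)) ⟩
    - sgn (n N./ 2) * invFact n                              ≡⟨ neg-distribˡ-* (sgn (n N./ 2)) (invFact n) ⟨
    - (sgn (n N./ 2) * invFact n)                            ∎
    where suc-even = trans (isEven-suc n) (cong not e)

  cosSq : PS1
  cosSq = cosS ·₁ cosS

  cosSq·secSq≡one₁ : ∀ n → (cosSq ·₁ secSq) n ≡ one₁ n
  cosSq·secSq≡one₁ = ·₁-recip₁ cosSq refl

  deriv-cosSq : ∀ n → deriv cosSq n ≡ - ((sinS ·₁ cosS) n + (sinS ·₁ cosS) n)
  deriv-cosSq n = trans (deriv-·₁ cosS cosS n) (trans (cong₂ _+_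
     (trans (·₁-cong {g = cosS} deriv-cosS (λ _ → refl) n) (neg-distribˡ-·₁ sinS cosS n))
     (trans (·₁-cong {f = cosS} (λ _ → refl) deriv-cosS n)
            (trans (neg-distribʳ-·₁ cosS sinS n) (cong -_ (·₁-comm cosS sinS n)))))
     (sym (neg-distrib-+ ((sinS ·₁ cosS) n) ((sinS ·₁ cosS) n))))

  -- cos² · (sec²)′ = −(cos²)′ · sec² = 2 sin cos sec², and cos is a unit, so cos · (sec²)′ = 2 sin sec².
  cosS·deriv-secSq : ∀ n → (cosS ·₁ deriv secSq) n ≡ (sinS ·₁ secSq) n + (sinS ·₁ secSq) n
  cosS·deriv-secSq n = begin
    (cosS ·₁ deriv secSq) n                ≡⟨ solve 2 (λ x y → x := (x :+ :- y) :+ y) refl ((cosS ·₁ deriv secSq) n) (ss n + ss n) ⟩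
    residual n + (ss n + ss n)             ≡⟨ cong (_+ (ss n + ss n)) (·₁-unit-zero cosS residual refl cosS·residual≡0 n) ⟩
    0ℚ + (ss n + ss n)                     ≡⟨ +-identityˡ _ ⟩
    ss n + ss n                            ∎
    where
    ss residual : PS1
    ss = sinS ·₁ secSq
    residual n = (cosS ·₁ deriv secSq) n + - (ss n + ss n)
    cosS·ss≡sinCos·secSq : ∀ n → (cosS ·₁ ss) n ≡ ((sinS ·₁ cosS) ·₁ secSq) n
    cosS·ss≡sinCos·secSq n = trans (sym (·₁-assoc n cosS sinS secSq)) (·₁-cong {g = secSq} (·₁-comm cosS sinS) (λ _ → refl) n)
    deriv-cosSq·secSq : ∀ n → (deriv cosSq ·₁ secSq) n ≡ - (((sinS ·₁ cosS) ·₁ secSq) n + ((sinS ·₁ cosS) ·₁ secSq) n)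
    deriv-cosSq·secSq n = trans (·₁-cong {g = secSq} deriv-cosSq (λ _ → refl) n)
      (trans (neg-distribˡ-·₁ (λ i → (sinS ·₁ cosS) i + (sinS ·₁ cosS) i) secSq n)
             (cong -_ (·₁-distribʳ-+ (sinS ·₁ cosS) (sinS ·₁ cosS) secSq n)))
    deriv[cosSq·secSq]≡0 : ∀ n → (deriv cosSq ·₁ secSq) n + (cosSq ·₁ deriv secSq) n ≡ 0ℚ
    deriv[cosSq·secSq]≡0 n = trans (sym (deriv-·₁ cosSq secSq n))
      (trans (cong (fromℕ (suc n) *_) (cosSq·secSq≡one₁ (suc n))) (*-zeroʳ (fromℕ (suc n))))
    cosS·residual≡0 : ∀ n → (cosS ·₁ residual) n ≡ 0ℚ
    cosS·residual≡0 n = begin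
      (cosS ·₁ residual) n
        ≡⟨ ·₁-distribˡ-+ cosS (cosS ·₁ deriv secSq) (λ i → - (ss i + ss i)) n ⟩
      (cosS ·₁ (cosS ·₁ deriv secSq)) n + (cosS ·₁ (λ i → - (ss i + ss i))) n
        ≡⟨ cong₂ _+_ (sym (·₁-assoc n cosS cosS (deriv secSq)))
                     (trans (neg-distribʳ-·₁ cosS (λ i → ss i + ss i) n) (cong -_ (·₁-distribˡ-+ cosS ss ss n))) ⟩
      (cosSq ·₁ deriv secSq) n + - ((cosS ·₁ ss) n + (cosS ·₁ ss) n)
        ≡⟨ cong (λ x → (cosSq ·₁ deriv secSq) n + - (x + x)) (cosS·ss≡sinCos·secSq n) ⟩
      (cosSq ·₁ deriv secSq) n + - (((sinS ·₁ cosS) ·₁ secSq) n + ((sinS ·₁ cosS) ·₁ secSq) n)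
        ≡⟨ cong ((cosSq ·₁ deriv secSq) n +_) (sym (deriv-cosSq·secSq n)) ⟩
      (cosSq ·₁ deriv secSq) n + (deriv cosSq ·₁ secSq) n
        ≡⟨ +-comm ((cosSq ·₁ deriv secSq) n) ((deriv cosSq ·₁ secSq) n) ⟩
      (deriv cosSq ·₁ secSq) n + (cosSq ·₁ deriv secSq) n
        ≡⟨ deriv[cosSq·secSq]≡0 n ⟩
      0ℚ ∎

  deriv-cosS·secSq : ∀ n → deriv (cosS ·₁ secSq) n ≡ (sinS ·₁ secSq) n
  deriv-cosS·secSq n = trans (deriv-·₁ cosS secSq n) (trans (cong₂ _+_
      (trans (·₁-cong {g = secSq} deriv-cosS (λ _ → refl) n) (neg-distribˡ-·₁ sinS secSq n))
      (cosS·deriv-secSq n))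
    (solve 1 (λ x → :- x :+ (x :+ x) := x) refl ((sinS ·₁ secSq) n)))

  ∂x ∂y ∂z : PS3 → PS3
  ∂x F a b c = fromℕ (suc a) * F (suc a) b c
  ∂y F a b c = fromℕ (suc b) * F a (suc b) c
  ∂z F a b c = fromℕ (suc c) * F a b (suc c)

  0₃ : PS3
  0₃ a b c = 0ℚ

  ≈₃-refl : ∀ {F} → F ≈₃ F
  ≈₃-refl a b c = refl

  ·₃-cong : ∀ {F F′ G G′} → F ≈₃ F′ → G ≈₃ G′ → (F ·₃ G) ≈₃ (F′ ·₃ G′)
  ·₃-cong p q a b c = Σ₀-ext a (λ i → Σ₀-ext b (λ j → Σ₀-ext c (λ l → cong₂ _*_ (p i j l) (q (a ∸ i) (b ∸ j) (c ∸ l)))))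

  ·₃-zeroˡ : ∀ {F} G → F ≈₃ 0₃ → (F ·₃ G) ≈₃ 0₃
  ·₃-zeroˡ G p a b c = Σ₀-zero a (λ i _ → Σ₀-zero b (λ j _ → Σ₀-zero c (λ l _ →
    trans (cong (_* G (a ∸ i) (b ∸ j) (c ∸ l)) (p i j l)) (*-zeroˡ (G (a ∸ i) (b ∸ j) (c ∸ l))))))

  ·₃-zeroʳ : ∀ F {G} → G ≈₃ 0₃ → (F ·₃ G) ≈₃ 0₃
  ·₃-zeroʳ F p a b c = Σ₀-zero a (λ i _ → Σ₀-zero b (λ j _ → Σ₀-zero c (λ l _ →
    trans (cong (F i j l *_) (p (a ∸ i) (b ∸ j) (c ∸ l))) (*-zeroʳ (F i j l)))))

  Σ₀³-+ : ∀ a b c (f g : ℕ → ℕ → ℕ → ℚ) →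
    Σ₀ a (λ i → Σ₀ b (λ j → Σ₀ c (λ l → f i j l + g i j l)))
    ≡ Σ₀ a (λ i → Σ₀ b (λ j → Σ₀ c (f i j))) + Σ₀ a (λ i → Σ₀ b (λ j → Σ₀ c (g i j)))
  Σ₀³-+ a b c f g = trans (Σ₀-ext a (λ i → trans (Σ₀-ext b (λ j → Σ₀-+ c (f i j) (g i j))) (Σ₀-+ b _ _))) (Σ₀-+ a _ _)

  ·₃-distribʳ-+ : ∀ F F′ G a b c → ((λ i j l → F i j l + F′ i j l) ·₃ G) a b c ≡ (F ·₃ G) a b c + (F′ ·₃ G) a b c
  ·₃-distribʳ-+ F F′ G a b c = trans
    (Σ₀-ext a (λ i → Σ₀-ext b (λ j → Σ₀-ext c (λ l → *-distribʳ-+ (G (a ∸ i) (b ∸ j) (c ∸ l)) (F i j l) (F′ i j l)))))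
    (Σ₀³-+ a b c _ _)

  *-distribˡ-Σ₀² : ∀ b c k (f : ℕ → ℕ → ℚ) → k * Σ₀ b (λ j → Σ₀ c (f j)) ≡ Σ₀ b (λ j → Σ₀ c (λ l → k * f j l))
  *-distribˡ-Σ₀² b c k f = trans (*-distribˡ-Σ₀ b k _) (Σ₀-ext b (λ j → *-distribˡ-Σ₀ c k (f j)))

  k*[x*y]≡x*[k*y] : ∀ k x y → k * (x * y) ≡ x * (k * y)
  k*[x*y]≡x*[k*y] = solve 3 (λ k x y → k :* (x :* y) := x :* (k :* y)) refl

  Leibniz : (PS3 → PS3) → Set
  Leibniz D = ∀ F G a b c → D (F ·₃ G) a b c ≡ (D F ·₃ G) a b c + (F ·₃ D G) a b c

  ∂x-leibniz : Leibniz ∂x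
  ∂x-leibniz F G a b c = trans (leibniz-Σ₀ a φ) (cong₂ _+_ (Σ₀-ext a left) (Σ₀-ext a right))
    where
    φ : ℕ → ℕ → ℚ
    φ i i′ = Σ₀ b (λ j → Σ₀ c (λ l → F i j l * G i′ (b ∸ j) (c ∸ l)))
    left : ∀ i → fromℕ (suc i) * φ (suc i) (a ∸ i) ≡ Σ₀ b (λ j → Σ₀ c (λ l → ∂x F i j l * G (a ∸ i) (b ∸ j) (c ∸ l)))
    left i = trans (*-distribˡ-Σ₀² b c (fromℕ (suc i)) _)
      (Σ₀-ext b (λ j → Σ₀-ext c (λ l → sym (*-assoc (fromℕ (suc i)) (F (suc i) j l) (G (a ∸ i) (b ∸ j) (c ∸ l))))))
    right : ∀ i → fromℕ (suc (a ∸ i)) * φ i (suc (a ∸ i))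
                ≡ Σ₀ b (λ j → Σ₀ c (λ l → F i j l * ∂x G (a ∸ i) (b ∸ j) (c ∸ l)))
    right i = trans (*-distribˡ-Σ₀² b c (fromℕ (suc (a ∸ i))) _)
      (Σ₀-ext b (λ j → Σ₀-ext c (λ l → k*[x*y]≡x*[k*y] (fromℕ (suc (a ∸ i))) (F i j l) (G (suc (a ∸ i)) (b ∸ j) (c ∸ l)))))

  ∂y-leibniz : Leibniz ∂y
  ∂y-leibniz F G a b c = trans (*-distribˡ-Σ₀ a (fromℕ (suc b)) _) (trans (Σ₀-ext a inner) (Σ₀-+ a _ _))
    where
    φ : ℕ → ℕ → ℕ → ℚ
    φ i j j′ = Σ₀ c (λ l → F i j l * G (a ∸ i) j′ (c ∸ l))
    inner : ∀ i → fromℕ (suc b) * Σ₀ (suc b) (λ j → φ i j (suc b ∸ j)) ≡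
        Σ₀ b (λ j → Σ₀ c (λ l → ∂y F i j l * G (a ∸ i) (b ∸ j) (c ∸ l)))
      + Σ₀ b (λ j → Σ₀ c (λ l → F i j l * ∂y G (a ∸ i) (b ∸ j) (c ∸ l)))
    inner i = trans (leibniz-Σ₀ b (φ i)) (cong₂ _+_
      (Σ₀-ext b (λ j → trans (*-distribˡ-Σ₀ c (fromℕ (suc j)) _)
        (Σ₀-ext c (λ l → sym (*-assoc (fromℕ (suc j)) (F i (suc j) l) (G (a ∸ i) (b ∸ j) (c ∸ l)))))))
      (Σ₀-ext b (λ j → trans (*-distribˡ-Σ₀ c (fromℕ (suc (b ∸ j))) _)
        (Σ₀-ext c (λ l → k*[x*y]≡x*[k*y] (fromℕ (suc (b ∸ j))) (F i j l) (G (a ∸ i) (suc (b ∸ j)) (c ∸ l)))))))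

  ∂z-leibniz : Leibniz ∂z
  ∂z-leibniz F G a b c = trans (*-distribˡ-Σ₀ a (fromℕ (suc c)) _) (trans (Σ₀-ext a outer) (Σ₀-+ a _ _))
    where
    φ : ℕ → ℕ → ℕ → ℕ → ℚ
    φ i j l l′ = F i j l * G (a ∸ i) (b ∸ j) l′
    inner : ∀ i j → fromℕ (suc c) * Σ₀ (suc c) (λ l → φ i j l (suc c ∸ l)) ≡
      Σ₀ c (λ l → ∂z F i j l * G (a ∸ i) (b ∸ j) (c ∸ l)) + Σ₀ c (λ l → F i j l * ∂z G (a ∸ i) (b ∸ j) (c ∸ l))
    inner i j = trans (leibniz-Σ₀ c (φ i j))
      (cong₂ _+_ (Σ₀-ext c (λ l → sym (*-assoc (fromℕ (suc l)) (F i j (suc l)) (G (a ∸ i) (b ∸ j) (c ∸ l)))))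
                 (Σ₀-ext c (λ l → k*[x*y]≡x*[k*y] (fromℕ (suc (c ∸ l))) (F i j l) (G (a ∸ i) (b ∸ j) (suc (c ∸ l))))))
    outer : ∀ i → fromℕ (suc c) * Σ₀ b (λ j → Σ₀ (suc c) (λ l → φ i j l (suc c ∸ l))) ≡
        Σ₀ b (λ j → Σ₀ c (λ l → ∂z F i j l * G (a ∸ i) (b ∸ j) (c ∸ l)))
      + Σ₀ b (λ j → Σ₀ c (λ l → F i j l * ∂z G (a ∸ i) (b ∸ j) (c ∸ l)))
    outer i = trans (*-distribˡ-Σ₀ b (fromℕ (suc c)) _) (trans (Σ₀-ext b (inner i)) (Σ₀-+ b _ _))

  leibniz-·₃-·₃ : ∀ D → Leibniz D → ∀ F G H a b c →
    D ((F ·₃ G) ·₃ H) a b c ≡ ((D F ·₃ G) ·₃ H) a b c + ((F ·₃ D G) ·₃ H) a b c + ((F ·₃ G) ·₃ D H) a b c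
  leibniz-·₃-·₃ D L F G H a b c = trans (L (F ·₃ G) H a b c) (cong (_+ ((F ·₃ G) ·₃ D H) a b c)
    (trans (·₃-cong {G = H} (L F G) ≈₃-refl a b c) (·₃-distribʳ-+ (D F ·₃ G) (F ·₃ D G) H a b c)))

  -- Differentiating in a variable of exponent k the coefficient f (s+1) (s+1)! / ((k+1)! ⋯) of a
  -- substituted series f (x + ⋯) gives f′ (s) s! / (k! ⋯).
  ∂-multinomial : ∀ (f : PS1) s k Y →
    fromℕ (suc k) * (f (suc s) * (fromℕ (suc s !) * (invFact (suc k) * Y))) ≡ deriv f s * (fromℕ (s !) * (invFact k * Y))
  ∂-multinomial f s k Y = begin
    fromℕ (suc k) * (f (suc s) * (fromℕ (suc s !) * (invFact (suc k) * Y)))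
      ≡⟨ cong (λ z → fromℕ (suc k) * (f (suc s) * (z * (invFact (suc k) * Y)))) (fromℕ-* (suc s) (s !)) ⟩
    fromℕ (suc k) * (f (suc s) * (fromℕ (suc s) * fromℕ (s !) * (invFact (suc k) * Y)))
      ≡⟨ solve 6 (λ K F S G I Y → K :* (F :* (S :* G :* (I :* Y))) := (S :* F) :* (G :* ((K :* I) :* Y))) refl
           (fromℕ (suc k)) (f (suc s)) (fromℕ (suc s)) (fromℕ (s !)) (invFact (suc k)) Y ⟩
    deriv f s * (fromℕ (s !) * (fromℕ (suc k) * invFact (suc k) * Y))
      ≡⟨ cong (λ z → deriv f s * (fromℕ (s !) * (z * Y))) (fromℕ[1+n]*invFact[1+n]≡invFact k) ⟩
    deriv f s * (fromℕ (s !) * (invFact k * Y)) ∎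

  ∂x-atX : ∀ f → ∂x (atX f) ≈₃ atX (deriv f)
  ∂x-atX f a zero    zero    = refl
  ∂x-atX f a zero    (suc c) = *-zeroʳ (fromℕ (suc a))
  ∂x-atX f a (suc b) c       = *-zeroʳ (fromℕ (suc a))

  ∂y-atX : ∀ f → ∂y (atX f) ≈₃ 0₃
  ∂y-atX f a b c = *-zeroʳ (fromℕ (suc b))

  ∂x-atZ : ∀ f → ∂x (atZ f) ≈₃ 0₃
  ∂x-atZ f a b c = *-zeroʳ (fromℕ (suc a))

  ∂y-atZ : ∀ f → ∂y (atZ f) ≈₃ 0₃
  ∂y-atZ f zero    b c = *-zeroʳ (fromℕ (suc b))
  ∂y-atZ f (suc a) b c = *-zeroʳ (fromℕ (suc b))

  ∂x-atXY : ∀ f → ∂x (atXY f) ≈₃ atXY (deriv f)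
  ∂x-atXY f a b zero    = ∂-multinomial f (a N.+ b) a (invFact b)
  ∂x-atXY f a b (suc c) = *-zeroʳ (fromℕ (suc a))

  ∂y-atXY : ∀ f → ∂y (atXY f) ≈₃ atXY (deriv f)
  ∂y-atXY f a b zero rewrite NP.+-suc a b = begin
    fromℕ (suc b) * (f (suc s) * (fromℕ (suc s !) * (invFact a * invFact (suc b))))
      ≡⟨ cong (λ z → fromℕ (suc b) * (f (suc s) * (fromℕ (suc s !) * z))) (*-comm (invFact a) (invFact (suc b))) ⟩
    fromℕ (suc b) * (f (suc s) * (fromℕ (suc s !) * (invFact (suc b) * invFact a)))
      ≡⟨ ∂-multinomial f s b (invFact a) ⟩
    deriv f s * (fromℕ (s !) * (invFact b * invFact a))
      ≡⟨ cong (λ z → deriv f s * (fromℕ (s !) * z)) (*-comm (invFact b) (invFact a)) ⟩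
    deriv f s * (fromℕ (s !) * (invFact a * invFact b)) ∎
    where s = a N.+ b
  ∂y-atXY f a b (suc c) = *-zeroʳ (fromℕ (suc b))

  ∂z-atXY : ∀ f → ∂z (atXY f) ≈₃ 0₃
  ∂z-atXY f a b c = *-zeroʳ (fromℕ (suc c))

  ∂x-atYZ : ∀ f → ∂x (atYZ f) ≈₃ 0₃
  ∂x-atYZ f a b c = *-zeroʳ (fromℕ (suc a))

  ∂y-atYZ : ∀ f → ∂y (atYZ f) ≈₃ atYZ (deriv f)
  ∂y-atYZ f zero    b c = ∂-multinomial f (b N.+ c) b (invFact c)
  ∂y-atYZ f (suc a) b c = *-zeroʳ (fromℕ (suc b))

  ∂z-atYZ : ∀ f → ∂z (atYZ f) ≈₃ atYZ (deriv f)
  ∂z-atYZ f zero b c rewrite NP.+-suc b c = begin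
    fromℕ (suc c) * (f (suc s) * (fromℕ (suc s !) * (invFact b * invFact (suc c))))
      ≡⟨ cong (λ z → fromℕ (suc c) * (f (suc s) * (fromℕ (suc s !) * z))) (*-comm (invFact b) (invFact (suc c))) ⟩
    fromℕ (suc c) * (f (suc s) * (fromℕ (suc s !) * (invFact (suc c) * invFact b)))
      ≡⟨ ∂-multinomial f s c (invFact b) ⟩
    deriv f s * (fromℕ (s !) * (invFact c * invFact b))
      ≡⟨ cong (λ z → deriv f s * (fromℕ (s !) * z)) (*-comm (invFact c) (invFact b)) ⟩
    deriv f s * (fromℕ (s !) * (invFact b * invFact c)) ∎
    where s = b N.+ c
  ∂z-atYZ f (suc a) b c = *-zeroʳ (fromℕ (suc c))

  ∂x-atXYZ : ∀ f → ∂x (atXYZ f) ≈₃ atXYZ (deriv f)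
  ∂x-atXYZ f a b c = begin
    fromℕ (suc a) * (f (suc s) * (fromℕ (suc s !) * (invFact (suc a) * invFact b * invFact c)))
      ≡⟨ cong (λ z → fromℕ (suc a) * (f (suc s) * (fromℕ (suc s !) * z))) (*-assoc (invFact (suc a)) (invFact b) (invFact c)) ⟩
    fromℕ (suc a) * (f (suc s) * (fromℕ (suc s !) * (invFact (suc a) * (invFact b * invFact c))))
      ≡⟨ ∂-multinomial f s a (invFact b * invFact c) ⟩
    deriv f s * (fromℕ (s !) * (invFact a * (invFact b * invFact c)))
      ≡⟨ cong (λ z → deriv f s * (fromℕ (s !) * z)) (sym (*-assoc (invFact a) (invFact b) (invFact c))) ⟩
    deriv f s * (fromℕ (s !) * (invFact a * invFact b * invFact c)) ∎
    where s = a N.+ b N.+ c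

  ∂y-atXYZ : ∀ f → ∂y (atXYZ f) ≈₃ atXYZ (deriv f)
  ∂y-atXYZ f a b c rewrite NP.+-suc a b = begin
    fromℕ (suc b) * (f (suc s) * (fromℕ (suc s !) * (invFact a * invFact (suc b) * invFact c)))
      ≡⟨ cong (λ z → fromℕ (suc b) * (f (suc s) * (fromℕ (suc s !) * z)))
           (solve 3 (λ x y z → x :* y :* z := y :* (x :* z)) refl (invFact a) (invFact (suc b)) (invFact c)) ⟩
    fromℕ (suc b) * (f (suc s) * (fromℕ (suc s !) * (invFact (suc b) * (invFact a * invFact c))))
      ≡⟨ ∂-multinomial f s b (invFact a * invFact c) ⟩
    deriv f s * (fromℕ (s !) * (invFact b * (invFact a * invFact c)))
      ≡⟨ cong (λ z → deriv f s * (fromℕ (s !) * z))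
           (solve 3 (λ x y z → y :* (x :* z) := x :* y :* z) refl (invFact a) (invFact b) (invFact c)) ⟩
    deriv f s * (fromℕ (s !) * (invFact a * invFact b * invFact c)) ∎
    where s = a N.+ b N.+ c

  ∂z-atXYZ : ∀ f → ∂z (atXYZ f) ≈₃ atXYZ (deriv f)
  ∂z-atXYZ f a b c rewrite NP.+-suc (a N.+ b) c = begin
    fromℕ (suc c) * (f (suc s) * (fromℕ (suc s !) * (invFact a * invFact b * invFact (suc c))))
      ≡⟨ cong (λ z → fromℕ (suc c) * (f (suc s) * (fromℕ (suc s !) * z)))
           (solve 3 (λ x y z → x :* y :* z := z :* (x :* y)) refl (invFact a) (invFact b) (invFact (suc c))) ⟩
    fromℕ (suc c) * (f (suc s) * (fromℕ (suc s !) * (invFact (suc c) * (invFact a * invFact b))))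
      ≡⟨ ∂-multinomial f s c (invFact a * invFact b) ⟩
    deriv f s * (fromℕ (s !) * (invFact c * (invFact a * invFact b)))
      ≡⟨ cong (λ z → deriv f s * (fromℕ (s !) * z))
           (solve 3 (λ x y z → z :* (x :* y) := x :* y :* z) refl (invFact a) (invFact b) (invFact c)) ⟩
    deriv f s * (fromℕ (s !) * (invFact a * invFact b * invFact c)) ∎
    where s = a N.+ b N.+ c

  neg₃ : PS3 → PS3
  neg₃ F a b c = - F a b c

  ·₃-negˡ : ∀ F G → (neg₃ F ·₃ G) ≈₃ neg₃ (F ·₃ G)
  ·₃-negˡ F G a b c = trans
    (Σ₀-ext a (λ i → Σ₀-ext b (λ j → Σ₀-ext c (λ l → sym (neg-distribˡ-* (F i j l) (G (a ∸ i) (b ∸ j) (c ∸ l)))))))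
    (sym (trans (neg-distrib-Σ₀ a _) (Σ₀-ext a (λ i → trans (neg-distrib-Σ₀ b _) (Σ₀-ext b (λ j → neg-distrib-Σ₀ c _))))))

  ·₃-negʳ : ∀ F G → (F ·₃ neg₃ G) ≈₃ neg₃ (F ·₃ G)
  ·₃-negʳ F G a b c = trans
    (Σ₀-ext a (λ i → Σ₀-ext b (λ j → Σ₀-ext c (λ l → sym (neg-distribʳ-* (F i j l) (G (a ∸ i) (b ∸ j) (c ∸ l)))))))
    (sym (trans (neg-distrib-Σ₀ a _) (Σ₀-ext a (λ i → trans (neg-distrib-Σ₀ b _) (Σ₀-ext b (λ j → neg-distrib-Σ₀ c _))))))

  atX-cong : ∀ {f g} → (∀ n → f n ≡ g n) → atX f ≈₃ atX g
  atX-cong p a zero    zero    = p a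
  atX-cong p a zero    (suc c) = refl
  atX-cong p a (suc b) c       = refl

  atX-neg : ∀ f → atX (λ n → - f n) ≈₃ neg₃ (atX f)
  atX-neg f a zero    zero    = refl
  atX-neg f a zero    (suc c) = refl
  atX-neg f a (suc b) c       = refl

  atYZ-cong : ∀ {f g} → (∀ n → f n ≡ g n) → atYZ f ≈₃ atYZ g
  atYZ-cong {f} p zero    b c = cong (_* _) (p (b N.+ c))
  atYZ-cong     p (suc a) b c = refl

  atYZ-neg : ∀ f → atYZ (λ n → - f n) ≈₃ neg₃ (atYZ f)
  atYZ-neg f zero    b c = sym (neg-distribˡ-* (f (b N.+ c)) _)
  atYZ-neg f (suc a) b c = refl

  secSq₃ : PS3
  secSq₃ = atXYZ secSq

  ∂x≈∂y-secSq₃ : ∂x secSq₃ ≈₃ ∂y secSq₃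
  ∂x≈∂y-secSq₃ a b c = trans (∂x-atXYZ secSq a b c) (sym (∂y-atXYZ secSq a b c))

  ∂z≈∂y-secSq₃ : ∂z secSq₃ ≈₃ ∂y secSq₃
  ∂z≈∂y-secSq₃ a b c = trans (∂z-atXYZ secSq a b c) (sym (∂y-atXYZ secSq a b c))

  f[x]g[z]sec² : PS1 → PS1 → PS3
  f[x]g[z]sec² f g = (atX f ·₃ atZ g) ·₃ secSq₃

  f[x+y]g[y+z]sec² : PS1 → PS1 → PS3
  f[x+y]g[y+z]sec² f g = (atXY f ·₃ atYZ g) ·₃ secSq₃

  f[x]g[z]sec²-negˡ : ∀ f g → f[x]g[z]sec² (λ n → - f n) g ≈₃ neg₃ (f[x]g[z]sec² f g)
  f[x]g[z]sec²-negˡ f g a b c = trans (·₃-cong {G = secSq₃} (·₃-cong {G = atZ g} (atX-neg f) ≈₃-refl) ≈₃-refl a b c)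
    (trans (·₃-cong {G = secSq₃} (·₃-negˡ (atX f) (atZ g)) ≈₃-refl a b c) (·₃-negˡ (atX f ·₃ atZ g) secSq₃ a b c))

  f[x+y]g[y+z]sec²-negʳ : ∀ f g → f[x+y]g[y+z]sec² f (λ n → - g n) ≈₃ neg₃ (f[x+y]g[y+z]sec² f g)
  f[x+y]g[y+z]sec²-negʳ f g a b c = trans (·₃-cong {G = secSq₃} (·₃-cong {F = atXY f} ≈₃-refl (atYZ-neg g)) ≈₃-refl a b c)
    (trans (·₃-cong {G = secSq₃} (·₃-negʳ (atXY f) (atYZ g)) ≈₃-refl a b c) (·₃-negˡ (atXY f ·₃ atYZ g) secSq₃ a b c))

  -- Only the factor f(x) distinguishes ∂x from ∂y.
  ∂x-f[x]g[z]sec² : ∀ f g a b c → ∂x (f[x]g[z]sec² f g) a b c ≡ ∂y (f[x]g[z]sec² f g) a b c + f[x]g[z]sec² (deriv f) g a b c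
  ∂x-f[x]g[z]sec² f g a b c = begin
    ∂x ((X ·₃ Z) ·₃ secSq₃) a b c
      ≡⟨ leibniz-·₃-·₃ ∂x ∂x-leibniz X Z secSq₃ a b c ⟩
    ((∂x X ·₃ Z) ·₃ secSq₃) a b c + ((X ·₃ ∂x Z) ·₃ secSq₃) a b c + ((X ·₃ Z) ·₃ ∂x secSq₃) a b c
      ≡⟨ cong₂ _+_ (cong₂ _+_ (·₃-cong {G = secSq₃} (·₃-cong {G = Z} (∂x-atX f) ≈₃-refl) ≈₃-refl a b c)
                              (·₃-zeroˡ secSq₃ (·₃-zeroʳ X (∂x-atZ g)) a b c))
                   (·₃-cong {F = X ·₃ Z} ≈₃-refl ∂x≈∂y-secSq₃ a b c) ⟩
    f[x]g[z]sec² (deriv f) g a b c + 0ℚ + T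
      ≡⟨ solve 2 (λ w t → w :+ con 0ℚ :+ t := con 0ℚ :+ con 0ℚ :+ t :+ w) refl (f[x]g[z]sec² (deriv f) g a b c) T ⟩
    0ℚ + 0ℚ + T + f[x]g[z]sec² (deriv f) g a b c
      ≡⟨ cong (λ u → u + T + f[x]g[z]sec² (deriv f) g a b c)
           (sym (cong₂ _+_ (·₃-zeroˡ secSq₃ (·₃-zeroˡ Z (∂y-atX f)) a b c) (·₃-zeroˡ secSq₃ (·₃-zeroʳ X (∂y-atZ g)) a b c))) ⟩
    ((∂y X ·₃ Z) ·₃ secSq₃) a b c + ((X ·₃ ∂y Z) ·₃ secSq₃) a b c + T + f[x]g[z]sec² (deriv f) g a b c
      ≡⟨ cong (_+ f[x]g[z]sec² (deriv f) g a b c) (sym (leibniz-·₃-·₃ ∂y ∂y-leibniz X Z secSq₃ a b c)) ⟩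
    ∂y ((X ·₃ Z) ·₃ secSq₃) a b c + f[x]g[z]sec² (deriv f) g a b c ∎
    where
    X = atX f
    Z = atZ g
    T = ((X ·₃ Z) ·₃ ∂y secSq₃) a b c

  -- Only the factor g(y+z) distinguishes ∂y from ∂x.
  ∂y-f[x+y]g[y+z]sec² : ∀ f g a b c →
    ∂y (f[x+y]g[y+z]sec² f g) a b c ≡ ∂x (f[x+y]g[y+z]sec² f g) a b c + f[x+y]g[y+z]sec² f (deriv g) a b c
  ∂y-f[x+y]g[y+z]sec² f g a b c = begin
    ∂y ((P ·₃ Q) ·₃ secSq₃) a b c
      ≡⟨ leibniz-·₃-·₃ ∂y ∂y-leibniz P Q secSq₃ a b c ⟩
    ((∂y P ·₃ Q) ·₃ secSq₃) a b c + ((P ·₃ ∂y Q) ·₃ secSq₃) a b c + ((P ·₃ Q) ·₃ ∂y secSq₃) a b c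
      ≡⟨ cong₂ _+_ (cong₂ _+_ (·₃-cong {G = secSq₃} (·₃-cong {G = Q} ∂y≈∂x-P ≈₃-refl) ≈₃-refl a b c)
                              (·₃-cong {G = secSq₃} (·₃-cong {F = P} ≈₃-refl (∂y-atYZ g)) ≈₃-refl a b c))
                   (sym (·₃-cong {F = P ·₃ Q} ≈₃-refl ∂x≈∂y-secSq₃ a b c)) ⟩
    T₁ + f[x+y]g[y+z]sec² f (deriv g) a b c + T₃
      ≡⟨ solve 3 (λ t w s → t :+ w :+ s := t :+ con 0ℚ :+ s :+ w) refl T₁ (f[x+y]g[y+z]sec² f (deriv g) a b c) T₃ ⟩
    T₁ + 0ℚ + T₃ + f[x+y]g[y+z]sec² f (deriv g) a b c
      ≡⟨ cong (λ u → T₁ + u + T₃ + f[x+y]g[y+z]sec² f (deriv g) a b c) (sym (·₃-zeroˡ secSq₃ (·₃-zeroʳ P (∂x-atYZ g)) a b c)) ⟩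
    T₁ + ((P ·₃ ∂x Q) ·₃ secSq₃) a b c + T₃ + f[x+y]g[y+z]sec² f (deriv g) a b c
      ≡⟨ cong (_+ f[x+y]g[y+z]sec² f (deriv g) a b c) (sym (leibniz-·₃-·₃ ∂x ∂x-leibniz P Q secSq₃ a b c)) ⟩
    ∂x ((P ·₃ Q) ·₃ secSq₃) a b c + f[x+y]g[y+z]sec² f (deriv g) a b c ∎
    where
    P = atXY f
    Q = atYZ g
    ∂y≈∂x-P : ∂y P ≈₃ ∂x P
    ∂y≈∂x-P a b c = trans (∂y-atXY f a b c) (sym (∂x-atXY f a b c))
    T₁ = ((∂x P ·₃ Q) ·₃ secSq₃) a b c
    T₃ = ((P ·₃ Q) ·₃ ∂x secSq₃) a b c

  -- Only the factor f(x+y) distinguishes ∂y from ∂z.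
  ∂y-f[x+y]g[y+z]sec²′ : ∀ f g a b c →
    ∂y (f[x+y]g[y+z]sec² f g) a b c ≡ f[x+y]g[y+z]sec² (deriv f) g a b c + ∂z (f[x+y]g[y+z]sec² f g) a b c
  ∂y-f[x+y]g[y+z]sec²′ f g a b c = begin
    ∂y ((P ·₃ Q) ·₃ secSq₃) a b c
      ≡⟨ leibniz-·₃-·₃ ∂y ∂y-leibniz P Q secSq₃ a b c ⟩
    ((∂y P ·₃ Q) ·₃ secSq₃) a b c + ((P ·₃ ∂y Q) ·₃ secSq₃) a b c + ((P ·₃ Q) ·₃ ∂y secSq₃) a b c
      ≡⟨ cong₂ _+_ (cong₂ _+_ (·₃-cong {G = secSq₃} (·₃-cong {G = Q} (∂y-atXY f) ≈₃-refl) ≈₃-refl a b c)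
                              (·₃-cong {G = secSq₃} (·₃-cong {F = P} ≈₃-refl ∂y≈∂z-Q) ≈₃-refl a b c))
                   (sym (·₃-cong {F = P ·₃ Q} ≈₃-refl ∂z≈∂y-secSq₃ a b c)) ⟩
    W + T₂ + T₃
      ≡⟨ solve 3 (λ w t s → w :+ t :+ s := w :+ (con 0ℚ :+ t :+ s)) refl W T₂ T₃ ⟩
    W + (0ℚ + T₂ + T₃)
      ≡⟨ cong (λ u → W + (u + T₂ + T₃)) (sym (·₃-zeroˡ secSq₃ (·₃-zeroˡ Q (∂z-atXY f)) a b c)) ⟩
    W + (((∂z P ·₃ Q) ·₃ secSq₃) a b c + T₂ + T₃)
      ≡⟨ cong (W +_) (sym (leibniz-·₃-·₃ ∂z ∂z-leibniz P Q secSq₃ a b c)) ⟩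
    W + ∂z ((P ·₃ Q) ·₃ secSq₃) a b c ∎
    where
    P = atXY f
    Q = atYZ g
    ∂y≈∂z-Q : ∂y Q ≈₃ ∂z Q
    ∂y≈∂z-Q a b c = trans (∂y-atYZ g a b c) (sym (∂z-atYZ g a b c))
    W = f[x+y]g[y+z]sec² (deriv f) g a b c
    T₂ = ((P ·₃ ∂z Q) ·₃ secSq₃) a b c
    T₃ = ((P ·₃ Q) ·₃ ∂z secSq₃) a b c

  f[x]g[z]sec²-congˡ : ∀ {f f′} g → (∀ n → f n ≡ f′ n) → f[x]g[z]sec² f g ≈₃ f[x]g[z]sec² f′ g
  f[x]g[z]sec²-congˡ g p = ·₃-cong {G = secSq₃} (·₃-cong {G = atZ g} (atX-cong p) ≈₃-refl) ≈₃-refl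

  f[x+y]g[y+z]sec²-congʳ : ∀ f {g g′} → (∀ n → g n ≡ g′ n) → f[x+y]g[y+z]sec² f g ≈₃ f[x+y]g[y+z]sec² f g′
  f[x+y]g[y+z]sec²-congʳ f p = ·₃-cong {G = secSq₃} (·₃-cong {F = atXY f} ≈₃-refl (atYZ-cong p)) ≈₃-refl

  -- The generating functions of the upper and lower triangles of the matrices A.
  companion₁ companion₂ : PS3
  companion₁ = f[x]g[z]sec² cosS cosS
  companion₂ = f[x+y]g[y+z]sec² cosS cosS

  y≡x+r⇒x≡y+r : ∀ x y r → y ≡ x + - r → x ≡ y + r
  y≡x+r⇒x≡y+r x y r y≡x-r = trans (solve 2 (λ x r → x := x :+ :- r :+ r) refl x r) (cong (_+ r) (sym y≡x-r))

  ∂x-rhs₁ : ∀ a b c → ∂x rhs₁ a b c ≡ ∂y rhs₁ a b c + companion₁ a b c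
  ∂x-rhs₁ a b c = trans (∂x-f[x]g[z]sec² sinS cosS a b c)
    (cong (∂y rhs₁ a b c +_) (f[x]g[z]sec²-congˡ cosS deriv-sinS a b c))

  ∂y-companion₁ : ∀ a b c → ∂y companion₁ a b c ≡ ∂x companion₁ a b c + rhs₁ a b c
  ∂y-companion₁ a b c = y≡x+r⇒x≡y+r _ _ (rhs₁ a b c) (trans (∂x-f[x]g[z]sec² cosS cosS a b c)
    (cong (∂y companion₁ a b c +_) (trans (f[x]g[z]sec²-congˡ cosS deriv-cosS a b c) (f[x]g[z]sec²-negˡ sinS cosS a b c))))

  ∂y-rhs₂ : ∀ a b c → ∂y rhs₂ a b c ≡ ∂x rhs₂ a b c + companion₂ a b c
  ∂y-rhs₂ a b c = trans (∂y-f[x+y]g[y+z]sec² cosS sinS a b c)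
    (cong (∂x rhs₂ a b c +_) (f[x+y]g[y+z]sec²-congʳ cosS deriv-sinS a b c))

  ∂x-companion₂ : ∀ a b c → ∂x companion₂ a b c ≡ ∂y companion₂ a b c + rhs₂ a b c
  ∂x-companion₂ a b c = y≡x+r⇒x≡y+r _ _ (rhs₂ a b c) (trans (∂y-f[x+y]g[y+z]sec² cosS cosS a b c)
    (cong (∂x companion₂ a b c +_) (trans (f[x+y]g[y+z]sec²-congʳ cosS deriv-cosS a b c) (f[x+y]g[y+z]sec²-negʳ cosS sinS a b c))))

  x*[n!*invFact]≡x : ∀ x n → x * (fromℕ (n !) * invFact n) ≡ x
  x*[n!*invFact]≡x x n = trans (cong (x *_) (fromℕ[n!]*invFact≡1 n)) (*-identityʳ x)

  atXY[n,0,0]≡f : ∀ f n → atXY f n 0 0 ≡ f n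
  atXY[n,0,0]≡f f n rewrite NP.+-identityʳ n =
    trans (cong (λ z → f n * (fromℕ (n !) * z)) (*-identityʳ (invFact n))) (x*[n!*invFact]≡x (f n) n)

  atYZ[0,0,n]≡f : ∀ f n → atYZ f 0 0 n ≡ f n
  atYZ[0,0,n]≡f f n = trans (cong (λ z → f n * (fromℕ (n !) * z)) (*-identityˡ (invFact n))) (x*[n!*invFact]≡x (f n) n)

  secSq₃[0,n,0]≡secSq : ∀ n → secSq₃ 0 n 0 ≡ secSq n
  secSq₃[0,n,0]≡secSq n rewrite NP.+-identityʳ n =
    trans (cong (λ z → secSq n * (fromℕ (n !) * z)) (solve 1 (λ x → con 1ℚ :* x :* con 1ℚ := x) refl (invFact n)))
          (x*[n!*invFact]≡x (secSq n) n)

  secSq₃[0,0,n]≡secSq : ∀ n → secSq₃ 0 0 n ≡ secSq n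
  secSq₃[0,0,n]≡secSq n =
    trans (cong (λ z → secSq n * (fromℕ (n !) * z)) (solve 1 (λ x → con 1ℚ :* con 1ℚ :* x := x) refl (invFact n)))
          (x*[n!*invFact]≡x (secSq n) n)

  secSq₃-swap-x-z : ∀ p q → secSq₃ p 0 q ≡ secSq₃ q 0 p
  secSq₃-swap-x-z p q = begin
    secSq (p N.+ 0 N.+ q) * (fromℕ ((p N.+ 0 N.+ q) !) * I)
      ≡⟨ cong (λ z → secSq z * (fromℕ (z !) * I)) p+0+q≡q+0+p ⟩
    secSq (q N.+ 0 N.+ p) * (fromℕ ((q N.+ 0 N.+ p) !) * I)
      ≡⟨ cong (λ z → secSq (q N.+ 0 N.+ p) * (fromℕ ((q N.+ 0 N.+ p) !) * z))
           (solve 3 (λ x y z → x :* y :* z := z :* y :* x) refl (invFact p) (invFact 0) (invFact q)) ⟩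
    secSq (q N.+ 0 N.+ p) * (fromℕ ((q N.+ 0 N.+ p) !) * (invFact q * invFact 0 * invFact p)) ∎
    where
    I = invFact p * invFact 0 * invFact q
    p+0+q≡q+0+p : p N.+ 0 N.+ q ≡ q N.+ 0 N.+ p
    p+0+q≡q+0+p = trans (cong (N._+ q) (NP.+-identityʳ p)) (trans (NP.+-comm p q) (cong (N._+ p) (sym (NP.+-identityʳ q))))

  atX·atZ[i,0,l] : ∀ f g i l → (atX f ·₃ atZ g) i 0 l ≡ f i * g l
  atX·atZ[i,0,l] f g i l = trans (Σ₀-only-last i (λ i′ i′<i → trans (inner i′)
      (trans (cong (f i′ *_) (atZ-x>0 (i ∸ i′) (NP.m<n⇒0<n∸m i′<i))) (*-zeroʳ (f i′)))))
    (trans (inner i) (cong (λ z → f i * atZ g z 0 l) (NP.n∸n≡0 i)))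
    where
    inner : ∀ i′ → Σ₀ l (λ l′ → atX f i′ 0 l′ * atZ g (i ∸ i′) 0 (l ∸ l′)) ≡ f i′ * atZ g (i ∸ i′) 0 l
    inner i′ = Σ₀-only-head l (λ k _ → *-zeroˡ (atZ g (i ∸ i′) 0 (l ∸ suc k)))
    atZ-x>0 : ∀ a → 0 < a → atZ g a 0 l ≡ 0ℚ
    atZ-x>0 (suc a) _ = refl

  atXY·atYZ[i,0,l] : ∀ f g i l → (atXY f ·₃ atYZ g) i 0 l ≡ f i * g l
  atXY·atYZ[i,0,l] f g i l = trans (Σ₀-only-last i (λ i′ i′<i → trans (inner i′)
      (trans (cong (atXY f i′ 0 0 *_) (atYZ-x>0 (i ∸ i′) (NP.m<n⇒0<n∸m i′<i))) (*-zeroʳ (atXY f i′ 0 0)))))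
    (trans (inner i) (trans (cong (λ z → atXY f i 0 0 * atYZ g z 0 l) (NP.n∸n≡0 i))
                            (cong₂ _*_ (atXY[n,0,0]≡f f i) (atYZ[0,0,n]≡f g l))))
    where
    inner : ∀ i′ → Σ₀ l (λ l′ → atXY f i′ 0 l′ * atYZ g (i ∸ i′) 0 (l ∸ l′)) ≡ atXY f i′ 0 0 * atYZ g (i ∸ i′) 0 l
    inner i′ = Σ₀-only-head l (λ k _ → *-zeroˡ (atYZ g (i ∸ i′) 0 (l ∸ suc k)))
    atYZ-x>0 : ∀ a → 0 < a → atYZ g a 0 l ≡ 0ℚ
    atYZ-x>0 (suc a) _ = refl

  -- At y = 0 both series reduce to f(x) g(z) sec²(x+z), up to exchanging x and z.
  f[x+y]g[y+z]sec²-mirror : ∀ f g a c → f[x+y]g[y+z]sec² f g c 0 a ≡ f[x]g[z]sec² g f a 0 c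
  f[x+y]g[y+z]sec²-mirror f g a c = begin
    Σ₀ c (λ i → Σ₀ a (λ l → (atXY f ·₃ atYZ g) i 0 l * secSq₃ (c ∸ i) 0 (a ∸ l)))
      ≡⟨ Σ₀-ext c (λ i → Σ₀-ext a (λ l → cong₂ _*_ (trans (atXY·atYZ[i,0,l] f g i l) (*-comm (f i) (g l)))
                                                    (secSq₃-swap-x-z (c ∸ i) (a ∸ l)))) ⟩
    Σ₀ c (λ i → Σ₀ a (λ l → g l * f i * secSq₃ (a ∸ l) 0 (c ∸ i)))
      ≡⟨ Σ₀-comm c a _ ⟩
    Σ₀ a (λ l → Σ₀ c (λ i → g l * f i * secSq₃ (a ∸ l) 0 (c ∸ i)))
      ≡⟨ Σ₀-ext a (λ i → Σ₀-ext c (λ l → cong (_* secSq₃ (a ∸ i) 0 (c ∸ l)) (sym (atX·atZ[i,0,l] g f i l)))) ⟩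
    Σ₀ a (λ i → Σ₀ c (λ l → (atX g ·₃ atZ f) i 0 l * secSq₃ (a ∸ i) 0 (c ∸ l))) ∎

  rhs₁[0,b,c]≡0 : ∀ b c → rhs₁ 0 b c ≡ 0ℚ
  rhs₁[0,b,c]≡0 b c = Σ₀-zero b (λ j _ → Σ₀-zero c (λ l _ →
    trans (cong (_* secSq₃ 0 (b ∸ j) (c ∸ l)) (sinX·cosZ[0,j,l]≡0 j l)) (*-zeroˡ (secSq₃ 0 (b ∸ j) (c ∸ l)))))
    where
    atX-sinS[0,j,l]≡0 : ∀ j l → atX sinS 0 j l ≡ 0ℚ
    atX-sinS[0,j,l]≡0 zero    zero    = refl
    atX-sinS[0,j,l]≡0 zero    (suc l) = refl
    atX-sinS[0,j,l]≡0 (suc j) l       = refl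
    sinX·cosZ[0,j,l]≡0 : ∀ j l → (atX sinS ·₃ atZ cosS) 0 j l ≡ 0ℚ
    sinX·cosZ[0,j,l]≡0 j l = Σ₀-zero j (λ j′ _ → Σ₀-zero l (λ l′ _ →
      trans (cong (_* atZ cosS 0 (j ∸ j′) (l ∸ l′)) (atX-sinS[0,j,l]≡0 j′ l′)) (*-zeroˡ (atZ cosS 0 (j ∸ j′) (l ∸ l′)))))

  companion₂[0,n,0]≡one₁ : ∀ n → companion₂ 0 n 0 ≡ one₁ n
  companion₂[0,n,0]≡one₁ n = trans (Σ₀-ext n (λ j → cong₂ _*_
      (Σ₀-ext j (λ j′ → cong₂ _*_ (atYZ[0,0,n]≡f cosS j′) (atXY[n,0,0]≡f cosS (j ∸ j′)))) (secSq₃[0,n,0]≡secSq (n ∸ j))))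
    (cosSq·secSq≡one₁ n)

  f[x+y]g[y+z]sec²[0,0,n] : ∀ f g n → f[x+y]g[y+z]sec² f g 0 0 n ≡ f 0 * (g ·₁ secSq) n
  f[x+y]g[y+z]sec²[0,0,n] f g n = begin
    Σ₀ n (λ l → (atXY f ·₃ atYZ g) 0 0 l * secSq₃ 0 0 (n ∸ l))
      ≡⟨ Σ₀-ext n (λ l → cong₂ _*_ (trans (Σ₀-only-head l (λ k _ → *-zeroˡ (atYZ g 0 0 (l ∸ suc k))))
                                          (cong₂ _*_ (*-identityʳ (f 0)) (atYZ[0,0,n]≡f g l)))
                                   (secSq₃[0,0,n]≡secSq (n ∸ l))) ⟩
    Σ₀ n (λ l → f 0 * g l * secSq (n ∸ l))
      ≡⟨ Σ₀-ext n (λ l → *-assoc (f 0) (g l) (secSq (n ∸ l))) ⟩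
    Σ₀ n (λ l → f 0 * (g l * secSq (n ∸ l)))
      ≡⟨ *-distribˡ-Σ₀ n (f 0) _ ⟨
    f 0 * (g ·₁ secSq) n ∎

  -- At x = 0 the series is f(y) sec(y+z), and (sec u)′ = sin u sec² u.  The base case is the one-variable
  -- identity; the induction on the degree in y trades ∂y for ∂z, generalising over f.
  ∂z-f[x+y]cos[y+z]sec² : ∀ b f c → ∂z (f[x+y]g[y+z]sec² f cosS) 0 b c ≡ f[x+y]g[y+z]sec² f sinS 0 b c
  ∂z-f[x+y]cos[y+z]sec² zero f c = begin
    fromℕ (suc c) * f[x+y]g[y+z]sec² f cosS 0 0 (suc c)
      ≡⟨ cong (fromℕ (suc c) *_) (f[x+y]g[y+z]sec²[0,0,n] f cosS (suc c)) ⟩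
    fromℕ (suc c) * (f 0 * (cosS ·₁ secSq) (suc c))
      ≡⟨ k*[x*y]≡x*[k*y] (fromℕ (suc c)) (f 0) ((cosS ·₁ secSq) (suc c)) ⟩
    f 0 * deriv (cosS ·₁ secSq) c
      ≡⟨ cong (f 0 *_) (deriv-cosS·secSq c) ⟩
    f 0 * (sinS ·₁ secSq) c
      ≡⟨ f[x+y]g[y+z]sec²[0,0,n] f sinS c ⟨
    f[x+y]g[y+z]sec² f sinS 0 0 c ∎
  ∂z-f[x+y]cos[y+z]sec² (suc b) f c = *-cancelˡ-fromℕ-suc b (begin
    fromℕ (suc b) * (fromℕ (suc c) * C f 0 (suc b) (suc c))
      ≡⟨ k*[x*y]≡x*[k*y] (fromℕ (suc b)) (fromℕ (suc c)) (C f 0 (suc b) (suc c)) ⟩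
    fromℕ (suc c) * ∂y (C f) 0 b (suc c)
      ≡⟨ cong (fromℕ (suc c) *_) (∂y-f[x+y]g[y+z]sec²′ f cosS 0 b (suc c)) ⟩
    fromℕ (suc c) * (C (deriv f) 0 b (suc c) + ∂z (C f) 0 b (suc c))
      ≡⟨ *-distribˡ-+ (fromℕ (suc c)) (C (deriv f) 0 b (suc c)) (∂z (C f) 0 b (suc c)) ⟩
    ∂z (C (deriv f)) 0 b c + fromℕ (suc c) * ∂z (C f) 0 b (suc c)
      ≡⟨ cong₂ (λ u v → u + fromℕ (suc c) * v) (∂z-f[x+y]cos[y+z]sec² b (deriv f) c) (∂z-f[x+y]cos[y+z]sec² b f (suc c)) ⟩
    S (deriv f) 0 b c + ∂z (S f) 0 b c
      ≡⟨ ∂y-f[x+y]g[y+z]sec²′ f sinS 0 b c ⟨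
    fromℕ (suc b) * S f 0 (suc b) c ∎)
    where
    C S : PS1 → PS3
    C f = f[x+y]g[y+z]sec² f cosS
    S f = f[x+y]g[y+z]sec² f sinS

  ∂z-companion₂[0,b,c] : ∀ b c → ∂z companion₂ 0 b c ≡ rhs₂ 0 b c
  ∂z-companion₂[0,b,c] b c = ∂z-f[x+y]cos[y+z]sec² b cosS c

  _⇔ᵇ_ : Bool → Bool → Bool
  true  ⇔ᵇ q = q
  false ⇔ᵇ q = not q

  isEven-+ : ∀ m n → isEven (m N.+ n) ≡ isEven m ⇔ᵇ isEven n
  isEven-+ zero          n = refl
  isEven-+ (suc zero)    n = isEven-suc n
  isEven-+ (suc (suc m)) n = isEven-+ m n

  ⇔ᵇ-mismatch : ∀ p q e e′ → p ⇔ᵇ q ≡ not (e ⇔ᵇ e′) → p ≡ not e ⊎ q ≡ not e′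
  ⇔ᵇ-mismatch true  q true  e′ h = inj₂ h
  ⇔ᵇ-mismatch true  q false e′ h = inj₁ refl
  ⇔ᵇ-mismatch false q true  e′ h = inj₁ refl
  ⇔ᵇ-mismatch false q false e′ h = inj₂ (not-injective h)

  -- Supported₁ true f: f is even; Supported₁ false f: f is odd (likewise for the total degree of a PS3).
  Supported₁ : Bool → PS1 → Set
  Supported₁ e f = ∀ n → isEven n ≡ not e → f n ≡ 0ℚ

  Supported₃ : Bool → PS3 → Set
  Supported₃ e F = ∀ a b c → isEven (a N.+ b N.+ c) ≡ not e → F a b c ≡ 0ℚ

  *-zero-by-parity : ∀ {e e′} x y p q → (p ≡ not e → x ≡ 0ℚ) → (q ≡ not e′ → y ≡ 0ℚ) →
                     p ⇔ᵇ q ≡ not (e ⇔ᵇ e′) → x * y ≡ 0ℚ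
  *-zero-by-parity {e} {e′} x y p q x≡0 y≡0 h with ⇔ᵇ-mismatch p q e e′ h
  ... | inj₁ r = trans (cong (_* y) (x≡0 r)) (*-zeroˡ y)
  ... | inj₂ r = trans (cong (x *_) (y≡0 r)) (*-zeroʳ x)

  sinS-supported : Supported₁ false sinS
  sinS-supported = sinS[even]≡0

  cosS-supported : Supported₁ true cosS
  cosS-supported = cosS[odd]≡0

  ·₁-supported : ∀ {e e′ f g} → Supported₁ e f → Supported₁ e′ g → Supported₁ (e ⇔ᵇ e′) (f ·₁ g)
  ·₁-supported {f = f} {g} sf sg n p = Σ₀-zero n (λ i i≤ →
    *-zero-by-parity (f i) (g (n ∸ i)) (isEven i) (isEven (n ∸ i)) (sf i) (sg (n ∸ i))
      (trans (sym (isEven-+ i (n ∸ i))) (trans (cong isEven (NP.m+[n∸m]≡n i≤)) p)))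

  recip₁-supported : ∀ g → Supported₁ true g → Supported₁ true (recip₁ g)
  recip₁-supported g sg n p = go n n NP.≤-refl p
    where
    go : ∀ N m → m ≤ N → isEven m ≡ false → recip₁ g m ≡ 0ℚ
    go N       zero    _         ()
    go (suc N) (suc m) (s≤s m≤N) q = trans (recip₁-suc g m) (cong -_ (Σ₀-zero m (λ i i≤ →
      *-zero-by-parity {true} {true} (g (suc i)) (recip₁ g (m ∸ i)) (isEven (suc i)) (isEven (m ∸ i)) (sg (suc i))
        (go N (m ∸ i) (NP.≤-trans (NP.m∸n≤m m i) m≤N))
        (trans (sym (isEven-+ (suc i) (m ∸ i))) (trans (cong isEven (cong suc (NP.m+[n∸m]≡n i≤))) q)))))

  secSq-supported : Supported₁ true secSq
  secSq-supported = recip₁-supported cosSq (·₁-supported {true} {true} cosS-supported cosS-supported)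

  ·₃-supported : ∀ {e e′ F G} → Supported₃ e F → Supported₃ e′ G → Supported₃ (e ⇔ᵇ e′) (F ·₃ G)
  ·₃-supported {F = F} {G} sF sG a b c p = Σ₀-zero a (λ i i≤ → Σ₀-zero b (λ j j≤ → Σ₀-zero c (λ l l≤ →
    *-zero-by-parity (F i j l) (G (a ∸ i) (b ∸ j) (c ∸ l)) _ _ (sF i j l) (sG (a ∸ i) (b ∸ j) (c ∸ l))
      (trans (sym (isEven-+ (i N.+ j N.+ l) _)) (trans (cong isEven (degree-split i≤ j≤ l≤)) p)))))
    where
    degree-split : ∀ {i j l a b c} → i ≤ a → j ≤ b → l ≤ c →
                   (i N.+ j N.+ l) N.+ ((a ∸ i) N.+ (b ∸ j) N.+ (c ∸ l)) ≡ a N.+ b N.+ c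
    degree-split {i} {j} {l} {a} {b} {c} i≤a j≤b l≤c = trans
      (solveℕ 6 (λ i j l x y z → (i ⊹ j ⊹ l) ⊹ (x ⊹ y ⊹ z) ≐ (i ⊹ x) ⊹ (j ⊹ y) ⊹ (l ⊹ z))
              refl i j l (a ∸ i) (b ∸ j) (c ∸ l))
      (cong₂ N._+_ (cong₂ N._+_ (NP.m+[n∸m]≡n i≤a) (NP.m+[n∸m]≡n j≤b)) (NP.m+[n∸m]≡n l≤c))

  f[n]*x≡0 : ∀ (f : PS1) n x → f n ≡ 0ℚ → f n * x ≡ 0ℚ
  f[n]*x≡0 f n x h = trans (cong (_* x) h) (*-zeroˡ x)

  atX-supported : ∀ {e f} → Supported₁ e f → Supported₃ e (atX f)
  atX-supported s a zero zero p = s a (trans (cong isEven (sym (trans (NP.+-identityʳ (a N.+ 0)) (NP.+-identityʳ a)))) p)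
  atX-supported s a zero (suc c) p = refl
  atX-supported s a (suc b) c p = refl

  atZ-supported : ∀ {e f} → Supported₁ e f → Supported₃ e (atZ f)
  atZ-supported s zero    zero    c p = s c p
  atZ-supported s zero    (suc b) c p = refl
  atZ-supported s (suc a) b       c p = refl

  atXY-supported : ∀ {e f} → Supported₁ e f → Supported₃ e (atXY f)
  atXY-supported {f = f} s a b zero p = f[n]*x≡0 f (a N.+ b) _ (s (a N.+ b) (trans (cong isEven (sym (NP.+-identityʳ (a N.+ b)))) p))
  atXY-supported s a b (suc c) p = refl

  atYZ-supported : ∀ {e f} → Supported₁ e f → Supported₃ e (atYZ f)
  atYZ-supported {f = f} s zero b c p = f[n]*x≡0 f (b N.+ c) _ (s (b N.+ c) p)
  atYZ-supported s (suc a) b c p = refl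

  secSq₃-supported : Supported₃ true secSq₃
  secSq₃-supported a b c p = f[n]*x≡0 secSq (a N.+ b N.+ c) _ (secSq-supported (a N.+ b N.+ c) p)

  rhs₁-supported : Supported₃ false rhs₁
  rhs₁-supported = ·₃-supported {false} {true}
    (·₃-supported {false} {true} (atX-supported sinS-supported) (atZ-supported cosS-supported)) secSq₃-supported

  rhs₂-supported : Supported₃ false rhs₂
  rhs₂-supported = ·₃-supported {false} {true}
    (·₃-supported {true} {false} (atXY-supported cosS-supported) (atYZ-supported sinS-supported)) secSq₃-supported

  expCoeff : PS3 → ℕ → ℕ → ℕ → ℚ
  expCoeff F a b c = F a b c * (fromℕ (a !) * (fromℕ (b !) * fromℕ (c !)))

  expCoeff-∂x : ∀ F a b c → expCoeff (∂x F) a b c ≡ expCoeff F (suc a) b c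
  expCoeff-∂x F a b c = trans
    (solve 5 (λ s f x y z → s :* f :* (x :* (y :* z)) := f :* ((s :* x) :* (y :* z))) refl
       (fromℕ (suc a)) (F (suc a) b c) (fromℕ (a !)) (fromℕ (b !)) (fromℕ (c !)))
    (cong (λ z → F (suc a) b c * (z * (fromℕ (b !) * fromℕ (c !)))) (sym (fromℕ-* (suc a) (a !))))

  expCoeff-∂y : ∀ F a b c → expCoeff (∂y F) a b c ≡ expCoeff F a (suc b) c
  expCoeff-∂y F a b c = trans
    (solve 5 (λ s f x y z → s :* f :* (x :* (y :* z)) := f :* (x :* ((s :* y) :* z))) refl
       (fromℕ (suc b)) (F a (suc b) c) (fromℕ (a !)) (fromℕ (b !)) (fromℕ (c !)))
    (cong (λ z → F a (suc b) c * (fromℕ (a !) * (z * fromℕ (c !)))) (sym (fromℕ-* (suc b) (b !))))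

  expCoeff-∂z : ∀ F a b c → expCoeff (∂z F) a b c ≡ expCoeff F a b (suc c)
  expCoeff-∂z F a b c = trans
    (solve 5 (λ s f x y z → s :* f :* (x :* (y :* z)) := f :* (x :* (y :* (s :* z)))) refl
       (fromℕ (suc c)) (F a b (suc c)) (fromℕ (a !)) (fromℕ (b !)) (fromℕ (c !)))
    (cong (λ z → F a b (suc c) * (fromℕ (a !) * (fromℕ (b !) * z))) (sym (fromℕ-* (suc c) (c !))))

  expCoeff-+ : ∀ F G H a b c → F a b c ≡ G a b c + H a b c → expCoeff F a b c ≡ expCoeff G a b c + expCoeff H a b c
  expCoeff-+ F G H a b c p = trans (cong (_* K) p) (*-distribʳ-+ K (G a b c) (H a b c))
    where K = fromℕ (a !) * (fromℕ (b !) * fromℕ (c !))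

  expCoeff-zero : ∀ F a b c → F a b c ≡ 0ℚ → expCoeff F a b c ≡ 0ℚ
  expCoeff-zero F a b c p = trans (cong (_* K) p) (*-zeroˡ K)
    where K = fromℕ (a !) * (fromℕ (b !) * fromℕ (c !))

  expCoeff-swap-x-z : ∀ F G a c → F c 0 a ≡ G a 0 c → expCoeff F c 0 a ≡ expCoeff G a 0 c
  expCoeff-swap-x-z F G a c p = cong₂ _*_ p
    (solve 2 (λ x y → x :* (con 1ℚ :* y) := y :* (con 1ℚ :* x)) refl (fromℕ (c !)) (fromℕ (a !)))

  expCoeff-rhs₁-x⁰ : ∀ b c → expCoeff rhs₁ 0 b c ≡ 0ℚ
  expCoeff-rhs₁-x⁰ b c = expCoeff-zero rhs₁ 0 b c (rhs₁[0,b,c]≡0 b c)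

  expCoeff-step-x : ∀ F G → (∀ a b c → ∂x F a b c ≡ ∂y F a b c + G a b c) →
                    ∀ a b c → expCoeff F (suc a) b c ≡ expCoeff F a (suc b) c + expCoeff G a b c
  expCoeff-step-x F G pde a b c = trans (sym (expCoeff-∂x F a b c))
    (trans (expCoeff-+ (∂x F) (∂y F) G a b c (pde a b c)) (cong (_+ expCoeff G a b c) (expCoeff-∂y F a b c)))

  expCoeff-step-y : ∀ F G → (∀ a b c → ∂y F a b c ≡ ∂x F a b c + G a b c) →
                    ∀ a b c → expCoeff F a (suc b) c ≡ expCoeff F (suc a) b c + expCoeff G a b c
  expCoeff-step-y F G pde a b c = trans (sym (expCoeff-∂y F a b c))
    (trans (expCoeff-+ (∂y F) (∂x F) G a b c (pde a b c)) (cong (_+ expCoeff G a b c) (expCoeff-∂x F a b c)))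

  expCoeff-rhs₂-mirror : ∀ a c → expCoeff rhs₂ c 0 a ≡ expCoeff rhs₁ a 0 c
  expCoeff-rhs₂-mirror a c = expCoeff-swap-x-z rhs₂ rhs₁ a c (f[x+y]g[y+z]sec²-mirror cosS sinS a c)

  expCoeff-companion₂-mirror : ∀ a c → expCoeff companion₂ c 0 a ≡ expCoeff companion₁ a 0 c
  expCoeff-companion₂-mirror a c = expCoeff-swap-x-z companion₂ companion₁ a c (f[x+y]g[y+z]sec²-mirror cosS cosS a c)

  expCoeff-companion₂-x⁰ : ∀ b c → expCoeff companion₂ 0 b (suc c) ≡ expCoeff rhs₂ 0 b c
  expCoeff-companion₂-x⁰ b c = trans (sym (expCoeff-∂z companion₂ 0 b c))
    (cong (_* (fromℕ (0 !) * (fromℕ (b !) * fromℕ (c !)))) (∂z-companion₂[0,b,c] b c))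

  expCoeff-companion₂-y-axis : ∀ b → expCoeff companion₂ 0 (suc b) 0 ≡ 0ℚ
  expCoeff-companion₂-y-axis b = expCoeff-zero companion₂ 0 (suc b) 0 (companion₂[0,n,0]≡one₁ (suc b))

  expCoeff-companion₂-origin : expCoeff companion₂ 0 0 0 ≡ 1ℚ
  expCoeff-companion₂-origin = cong (_* (fromℕ (0 !) * (fromℕ (0 !) * fromℕ (0 !)))) (companion₂[0,n,0]≡one₁ 0)

  expCoeff*invFacts≡coeff : ∀ F a b c → expCoeff F a b c * (invFact a * invFact b * invFact c) ≡ F a b c
  expCoeff*invFacts≡coeff F a b c = begin
    F a b c * (fa * (fb * fc)) * (ia * ib * ic)
      ≡⟨ solve 7 (λ f x y z u v w → f :* (x :* (y :* z)) :* (u :* v :* w) := f :* ((x :* u) :* ((y :* v) :* (z :* w))))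
           refl (F a b c) fa fb fc ia ib ic ⟩
    F a b c * ((fa * ia) * ((fb * ib) * (fc * ic)))
      ≡⟨ cong₂ (λ u v → F a b c * (u * v)) (fromℕ[n!]*invFact≡1 a) (cong₂ _*_ (fromℕ[n!]*invFact≡1 b) (fromℕ[n!]*invFact≡1 c)) ⟩
    F a b c * (1ℚ * (1ℚ * 1ℚ))
      ≡⟨ *-identityʳ (F a b c) ⟩
    F a b c ∎
    where
    fa = fromℕ (a !)
    fb = fromℕ (b !)
    fc = fromℕ (c !)
    ia = invFact a
    ib = invFact b
    ic = invFact c

module SeidelEntries {A B : MatSeq} (ts : TwinSeidel A B) where

  open import Data.Nat using (ℕ; zero; suc; _+_; _∸_; _≤_; _<_; z≤n; s≤s; pred; >-nonZero)
  open import Data.Nat.Properties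
  open import Relation.Binary.PropositionalEquality
  open ≡-Reasoning

  Σ₁-+ : ∀ p q f → Σ₁ (p + q) f ≡ Σ₁ p f + Σ₁ q (λ j → f (p + j))
  Σ₁-+ p zero f rewrite +-identityʳ p = sym (+-identityʳ _)
  Σ₁-+ p (suc q) f rewrite +-suc p q = trans (cong (_+ f (suc (p + q))) (Σ₁-+ p q f)) (+-assoc (Σ₁ p f) _ _)

  Σ₁-drop-last-zero : ∀ k f → f (suc k) ≡ 0 → Σ₁ (suc k) f ≡ Σ₁ k f
  Σ₁-drop-last-zero k f p = trans (cong (Σ₁ k f +_) p) (+-identityʳ _)

  open TwinSeidel ts

  3≤m+2 : ∀ {m} → 1 ≤ m → 3 ≤ m + 2
  3≤m+2 {m} 1≤m = subst (3 ≤_) (+-comm 2 m) (s≤s (s≤s 1≤m))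

  ts4-4′ : ∀ n m k → 3 ≤ n → 1 ≤ m → suc (suc m) ≤ k → k ≤ n ∸ 1 → B n (suc m) k ≡ B n m k + A (n ∸ 1) m (k ∸ 1)
  ts4-4′ n m k 3≤n 1≤m m+2≤k k≤n-1 = ts4-4 n m k 3≤n (3≤m+2 1≤m) (subst (_≤ k) (+-comm 2 m) m+2≤k) k≤n-1

  ts5-2′ : ∀ n m k → 3 ≤ n → 1 ≤ m → suc (suc m) ≤ k → k ≤ n ∸ 1 → A n m k ≡ A n (suc m) k + B (n ∸ 1) m (k ∸ 1)
  ts5-2′ n m k 3≤n 1≤m m+2≤k k≤n-1 = ts5-2 n m k 3≤n (3≤m+2 1≤m) (subst (_≤ k) (+-comm 2 m) m+2≤k) k≤n-1

  -- Summing (TS4) up column k+1 from row 1 and down column k from row k+1 gives the two parts of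
  -- the column sum a_{N-1}(•,k) = b_N(N-1,k), split at the vanishing diagonal entry.
  B[1+k,k]≡B[k,1+k] : ∀ M k → 2 ≤ M → 1 ≤ k → k ≤ M → B (2 + M) (suc k) k ≡ B (2 + M) k (suc k)
  B[1+k,k]≡B[k,1+k] M k 2≤M 1≤k k≤M = +-cancelʳ-≡ (Σ₁ t below) _ _ (begin
    B N (suc k) k + Σ₁ t below          ≡⟨ down t (≤-reflexive 1+k+t≡1+M) ⟨
    B N (suc k + t) k                   ≡⟨ cong (λ z → B N z k) 1+k+t≡1+M ⟩
    B N (suc M) k                       ≡⟨ ts4-2 N k 3≤N 1≤k k≤M ⟩
    colSum A (suc M) k                  ≡⟨ column ⟩
    Σ₁ k′ above + Σ₁ t below            ≡⟨ cong (_+ Σ₁ t below) (up k′ (subst (k′ <_) 1+k′≡k (n<1+n k′))) ⟨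
    B N (suc k′) (suc k) + Σ₁ t below   ≡⟨ cong (λ z → B N z (suc k) + Σ₁ t below) 1+k′≡k ⟩
    B N k (suc k) + Σ₁ t below          ∎)
    where
    N = 2 + M
    3≤N : 3 ≤ N
    3≤N = s≤s (s≤s (≤-trans (s≤s z≤n) 2≤M))
    3≤1+M : 3 ≤ suc M
    3≤1+M = s≤s 2≤M
    k≤1+M = ≤-trans k≤M (n≤1+n M)
    k′ = pred k
    1+k′≡k : suc k′ ≡ k
    1+k′≡k = suc-pred k {{>-nonZero 1≤k}}
    t = M ∸ k
    1+k+t≡1+M : suc k + t ≡ suc M
    1+k+t≡1+M = cong suc (m+[n∸m]≡n k≤M)
    above below : ℕ → ℕ
    above m = A (suc M) m k
    below j = A (suc M) (k + j) k
    up : ∀ t → t < k → B N (suc t) (suc k) ≡ Σ₁ t above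
    up zero    _     = ts2-b N (suc k) 3≤N (s≤s z≤n) (s≤s k≤1+M)
    up (suc t) 1+t<k = trans (ts4-4′ N (suc t) (suc k) 3≤N (s≤s z≤n) (s≤s 1+t<k) (s≤s k≤M))
      (cong (_+ A (suc M) (suc t) k) (up t (<-trans (n<1+n t) 1+t<k)))
    down : ∀ t → suc k + t ≤ suc M → B N (suc k + t) k ≡ B N (suc k) k + Σ₁ t below
    down zero    _ = trans (cong (λ z → B N z k) (+-identityʳ (suc k))) (sym (+-identityʳ _))
    down (suc t) h = begin
      B N (suc k + suc t) k
        ≡⟨ cong (λ z → B N z k) (+-suc (suc k) t) ⟩
      B N (suc (suc k + t)) k
        ≡⟨ ts4-3 N (suc k + t) k 3≤N (s≤s 1≤k) (m≤m+n (suc k) t) (≤-pred h′) ⟩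
      B N (suc k + t) k + A (suc M) (suc k + t) k
        ≡⟨ cong₂ _+_ (down t (≤-trans (n≤1+n _) h′)) (cong (λ z → A (suc M) z k) (sym (+-suc k t))) ⟩
      B N (suc k) k + Σ₁ t below + below (suc t)
        ≡⟨ +-assoc (B N (suc k) k) (Σ₁ t below) (below (suc t)) ⟩
      B N (suc k) k + Σ₁ (suc t) below ∎
      where
      h′ : suc (suc k + t) ≤ suc M
      h′ = subst (_≤ suc M) (+-suc (suc k) t) h
    column : colSum A (suc M) k ≡ Σ₁ k′ above + Σ₁ t below
    column = begin
      Σ₁ (suc M) above                ≡⟨ cong (λ z → Σ₁ z above) (trans (sym 1+k+t≡1+M) (sym (+-suc k t))) ⟩
      Σ₁ (k + suc t) above            ≡⟨ Σ₁-+ k (suc t) above ⟩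
      Σ₁ k above + Σ₁ (suc t) below   ≡⟨ cong (Σ₁ k above +_) (Σ₁-drop-last-zero t below last-row≡0) ⟩
      Σ₁ k above + Σ₁ t below         ≡⟨ cong (λ z → Σ₁ z above + Σ₁ t below) (sym 1+k′≡k) ⟩
      Σ₁ (suc k′) above + Σ₁ t below  ≡⟨ cong (_+ Σ₁ t below) (Σ₁-drop-last-zero k′ above diagonal≡0) ⟩
      Σ₁ k′ above + Σ₁ t below        ∎
      where
      last-row≡0 : below (suc t) ≡ 0
      last-row≡0 = trans (cong (λ z → A (suc M) z k) (trans (+-suc k t) 1+k+t≡1+M)) (ts2-a (suc M) k 3≤1+M 1≤k k≤1+M)
      diagonal≡0 : above (suc k′) ≡ 0
      diagonal≡0 rewrite 1+k′≡k = ts1-a (suc M) k (≤-trans (s≤s (s≤s z≤n)) 3≤1+M) 1≤k k≤1+M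
        (λ { (1+M≡2 , _) → <-irrefl (sym 1+M≡2) 3≤1+M })

  -- As above with the roles of A and B exchanged, summing (TS5) down column k+1 and down column k.
  A[k,1+k]≡A[1+k,k] : ∀ M k → 1 ≤ M → 1 ≤ k → k ≤ M → A (2 + M) k (suc k) ≡ A (2 + M) (suc k) k
  A[k,1+k]≡A[1+k,k] M k 1≤M 1≤k k≤M = +-cancelʳ-≡ (Σ₁ k′ above) _ _ (begin
    A N k (suc k) + Σ₁ k′ above              ≡⟨ cong (λ z → A N z (suc k) + Σ₁ k′ above) (sym 1+k′≡k) ⟩
    A N (suc k′) (suc k) + Σ₁ k′ above       ≡⟨ up k′ (≤-reflexive 1+k′≡k) ⟨
    A N 1 (suc k)                            ≡⟨ ts5-1 N (suc k) 3≤N (s≤s 1≤k) (s≤s k≤M) ⟩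
    colSum B (suc M) k                       ≡⟨ column ⟩
    Σ₁ k′ above + Σ₁ t below                 ≡⟨ cong (Σ₁ k′ above +_) below-sum ⟩
    Σ₁ k′ above + A N (suc k) k              ≡⟨ +-comm (Σ₁ k′ above) _ ⟩
    A N (suc k) k + Σ₁ k′ above              ∎)
    where
    N = 2 + M
    3≤N : 3 ≤ N
    3≤N = s≤s (s≤s 1≤M)
    k≤1+M = ≤-trans k≤M (n≤1+n M)
    k′ = pred k
    1+k′≡k : suc k′ ≡ k
    1+k′≡k = suc-pred k {{>-nonZero 1≤k}}
    t = suc M ∸ k
    k+t≡1+M : k + t ≡ suc M
    k+t≡1+M = m+[n∸m]≡n k≤1+M
    above below : ℕ → ℕ
    above j = B (suc M) j k
    below j = B (suc M) (k + j) k
    up : ∀ t → suc t ≤ k → A N 1 (suc k) ≡ A N (suc t) (suc k) + Σ₁ t above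
    up zero     _ = sym (+-identityʳ _)
    up (suc t) h = begin
      A N 1 (suc k)
        ≡⟨ up t (≤-trans (n≤1+n _) h) ⟩
      A N (suc t) (suc k) + Σ₁ t above
        ≡⟨ cong (_+ Σ₁ t above) (ts5-2′ N (suc t) (suc k) 3≤N (s≤s z≤n) (s≤s h) (s≤s k≤M)) ⟩
      A N (suc (suc t)) (suc k) + above (suc t) + Σ₁ t above
        ≡⟨ +-assoc (A N (suc (suc t)) (suc k)) _ _ ⟩
      A N (suc (suc t)) (suc k) + (above (suc t) + Σ₁ t above)
        ≡⟨ cong (A N (suc (suc t)) (suc k) +_) (+-comm (above (suc t)) _) ⟩
      A N (suc (suc t)) (suc k) + Σ₁ (suc t) above ∎
    down : ∀ t → suc k + t ≤ N → A N (suc k + t) k + Σ₁ t below ≡ A N (suc k) k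
    down zero    _ = trans (+-identityʳ _) (cong (λ z → A N z k) (+-identityʳ (suc k)))
    down (suc t) h = begin
      A N (suc k + suc t) k + (Σ₁ t below + B (suc M) (k + suc t) k)
        ≡⟨ cong₂ (λ u v → A N u k + (Σ₁ t below + B (suc M) v k)) (+-suc (suc k) t) (+-suc k t) ⟩
      A N (suc m) k + (Σ₁ t below + B (suc M) m k)
        ≡⟨ cong (A N (suc m) k +_) (+-comm (Σ₁ t below) (B (suc M) m k)) ⟩
      A N (suc m) k + (B (suc M) m k + Σ₁ t below)
        ≡⟨ +-assoc (A N (suc m) k) (B (suc M) m k) (Σ₁ t below) ⟨
      A N (suc m) k + B (suc M) m k + Σ₁ t below
        ≡⟨ cong (_+ Σ₁ t below) (ts5-3 N m k 3≤N (s≤s 1≤k) (m≤m+n (suc k) t) (≤-pred h′)) ⟨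
      A N m k + Σ₁ t below
        ≡⟨ down t (≤-trans (n≤1+n m) h′) ⟩
      A N (suc k) k ∎
      where
      m = suc k + t
      h′ : suc m ≤ N
      h′ = subst (_≤ N) (+-suc (suc k) t) h
    column : colSum B (suc M) k ≡ Σ₁ k′ above + Σ₁ t below
    column = begin
      Σ₁ (suc M) above                 ≡⟨ cong (λ z → Σ₁ z above) (sym k+t≡1+M) ⟩
      Σ₁ (k + t) above                 ≡⟨ Σ₁-+ k t above ⟩
      Σ₁ k above + Σ₁ t below          ≡⟨ cong (λ z → Σ₁ z above + Σ₁ t below) (sym 1+k′≡k) ⟩
      Σ₁ (suc k′) above + Σ₁ t below   ≡⟨ cong (_+ Σ₁ t below) (Σ₁-drop-last-zero k′ above
                                            (trans (cong above 1+k′≡k) (ts1-b (suc M) k (s≤s 1≤M) 1≤k k≤1+M))) ⟩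
      Σ₁ k′ above + Σ₁ t below         ∎
    below-sum : Σ₁ t below ≡ A N (suc k) k
    below-sum = begin
      Σ₁ t below                     ≡⟨ cong (_+ Σ₁ t below) (ts2-a N k 3≤N 1≤k (≤-trans k≤1+M (n≤1+n (suc M)))) ⟨
      A N N k + Σ₁ t below           ≡⟨ cong (λ z → A N z k + Σ₁ t below) (cong suc (sym k+t≡1+M)) ⟩
      A N (suc k + t) k + Σ₁ t below ≡⟨ down t (≤-reflexive (cong suc k+t≡1+M)) ⟩
      A N (suc k) k                  ∎

module EntriesAsCoefficients {A B : MatSeq} (ts : TwinSeidel A B) where

  open import Data.Nat using (ℕ; zero; suc; _+_; _∸_; _≤_; z≤n; s≤s; pred)
  open import Data.Nat.Properties
  open import Data.Product using (Σ-syntax; proj₁; proj₂)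
  open import Data.Bool using (true; false; not; if_then_else_)
  open import Data.Bool.Properties using (not-injective)
  import Data.Rational as Q
  open import Relation.Binary.PropositionalEquality
  open TwinSeidel ts
  open SeidelEntries ts using (ts4-4′; ts5-2′; B[1+k,k]≡B[k,1+k]; A[k,1+k]≡A[1+k,k])
  open Series using (fromℕ-+; isEven-+; _⇔ᵇ_; Supported₃; rhs₁-supported; rhs₂-supported; expCoeff;
    expCoeff*invFacts≡coeff; companion₁; companion₂; ∂x-rhs₁; ∂y-companion₁; ∂y-rhs₂; ∂x-companion₂;
    expCoeff-step-x; expCoeff-step-y; expCoeff-rhs₁-x⁰; expCoeff-rhs₂-mirror; expCoeff-companion₂-mirror;
    expCoeff-companion₂-x⁰; expCoeff-companion₂-y-axis; expCoeff-companion₂-origin)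

  UpperB UpperA LowerB LowerA : ℕ → Set
  UpperB N = ∀ a b c → 3 + (a + b + c) ≡ N → fromℕ (B N (suc a) (2 + (a + b))) ≡ expCoeff rhs₁ a b c
  UpperA N = ∀ a b c → 3 + (a + b + c) ≡ N → fromℕ (A N (suc a) (2 + (a + b))) ≡ expCoeff companion₁ a b c
  LowerB N = ∀ a b c → 3 + (a + b + c) ≡ N → fromℕ (B N (2 + (b + c)) (suc c)) ≡ expCoeff rhs₂ a b c
  LowerA N = ∀ a b c → 3 + (a + b + c) ≡ N → fromℕ (A N (2 + (b + c)) (suc c)) ≡ expCoeff companion₂ a b c

  -- By (TS5) the last row of B_N is row N of A_{N+1}, i.e. LowerA (N+1) at a = 0.
  LastRowB : ℕ → Set
  LastRowB N = ∀ b c → 2 + (b + c) ≡ N → fromℕ (B N N (suc c)) ≡ expCoeff companion₂ 0 b c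

  3≤3+ : ∀ x → 3 ≤ 3 + x
  3≤3+ x = s≤s (s≤s (s≤s z≤n))

  a+0+c≡c+0+a : ∀ a c → a + 0 + c ≡ c + 0 + a
  a+0+c≡c+0+a a c = trans (cong (_+ c) (+-identityʳ a)) (trans (+-comm a c) (cong (_+ a) (sym (+-identityʳ c))))

  lowerA : ∀ M → LastRowB M → LowerB M → LowerA (suc M)
  lowerA M lastB lowB zero b c refl = trans (cong fromℕ (trans
      (ts5-3 N m k (3≤3+ (b + c)) (s≤s (s≤s z≤n)) (s≤s (s≤s (m≤n+m c b))) ≤-refl)
      (cong (_+ B M m k) (ts2-a N k (3≤3+ (b + c)) (s≤s z≤n) (s≤s (≤-trans (m≤n+m c b) (≤-trans (n≤1+n _) (n≤1+n _))))))))
    (lastB b c refl)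
    where
    N = 3 + (b + c)
    m = 2 + (b + c)
    k = suc c
  lowerA M lastB lowB (suc a) b c refl = trans (cong fromℕ (ts5-3 N m k (3≤3+ _) (s≤s (s≤s z≤n)) (s≤s (s≤s (m≤n+m c b))) m≤N-1))
    (trans (fromℕ-+ (A N (suc m) k) (B (N ∸ 1) m k))
      (trans (cong₂ Q._+_ (lowerA M lastB lowB a (suc b) c (cong (λ z → 3 + (z + c)) (+-suc a b))) (lowB a b c refl))
             (sym (expCoeff-step-x companion₂ rhs₂ ∂x-companion₂ a b c))))
    where
    N = 3 + (suc a + b + c)
    m = 2 + (b + c)
    k = suc c
    m≤N-1 : m ≤ 2 + (suc a + b + c)
    m≤N-1 = s≤s (s≤s (≤-trans (+-monoˡ-≤ c (m≤n+m b a)) (n≤1+n _)))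

  upperA : ∀ M → UpperB M → LowerA (suc M) → UpperA (suc M)
  upperA M upB lowA a zero c refl = trans (cong (λ z → fromℕ (A N (suc a) (suc (suc z)))) (+-identityʳ a))
    (trans (cong fromℕ (A[k,1+k]≡A[1+k,k] (suc (a + 0 + c)) (suc a) (s≤s z≤n) (s≤s z≤n)
                          (s≤s (≤-trans (m≤m+n a 0) (m≤m+n (a + 0) c)))))
      (trans (lowA c 0 a (cong (3 +_) (a+0+c≡c+0+a c a))) (expCoeff-companion₂-mirror a c)))
    where N = 3 + (a + 0 + c)
  upperA M upB lowA a (suc b) c refl = trans (cong fromℕ (ts5-2′ N (suc a) k (3≤3+ _) (s≤s z≤n) 3+a≤k k≤N-1))
    (trans (fromℕ-+ (A N (suc (suc a)) k) (B (N ∸ 1) (suc a) (k ∸ 1)))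
      (trans (cong₂ Q._+_ next prev) (sym (expCoeff-step-y companion₁ rhs₁ ∂y-companion₁ a b c))))
    where
    N = 3 + (a + suc b + c)
    k = 2 + (a + suc b)
    3+a≤k : suc (suc (suc a)) ≤ k
    3+a≤k = s≤s (s≤s (subst (suc a ≤_) (sym (+-suc a b)) (s≤s (m≤m+n a b))))
    k≤N-1 : k ≤ N ∸ 1
    k≤N-1 = s≤s (s≤s (m≤m+n (a + suc b) c))
    next : fromℕ (A N (suc (suc a)) k) ≡ expCoeff companion₁ (suc a) b c
    next = trans (cong (λ z → fromℕ (A N (suc (suc a)) (suc (suc z)))) (+-suc a b))
                 (upperA M upB lowA (suc a) b c (cong (λ z → 3 + (z + c)) (sym (+-suc a b))))
    prev : fromℕ (B (N ∸ 1) (suc a) (k ∸ 1)) ≡ expCoeff rhs₁ a b c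
    prev = trans (cong (λ z → fromℕ (B (N ∸ 1) (suc a) (suc z))) (+-suc a b))
                 (upB a b c (cong (λ z → 2 + (z + c)) (sym (+-suc a b))))

  upperB : ∀ M → UpperA M → UpperB (suc M)
  upperB M upA zero b c refl = trans
    (cong fromℕ (ts2-b (3 + (b + c)) (2 + b) (3≤3+ _) (s≤s z≤n) (s≤s (s≤s (≤-trans (m≤m+n b c) (n≤1+n _))))))
    (sym (expCoeff-rhs₁-x⁰ b c))
  upperB M upA (suc a) b c refl = trans
    (cong fromℕ (ts4-4′ N (suc a) k (3≤3+ _) (s≤s z≤n) (s≤s (s≤s (s≤s (m≤m+n a b)))) (s≤s (s≤s (m≤m+n (suc a + b) c)))))
    (trans (fromℕ-+ (B N (suc a) k) (A (N ∸ 1) (suc a) (k ∸ 1)))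
      (trans (cong₂ Q._+_ next (upA a b c refl)) (sym (expCoeff-step-x rhs₁ companion₁ ∂x-rhs₁ a b c))))
    where
    N = 3 + (suc a + b + c)
    k = 2 + (suc a + b)
    next : fromℕ (B N (suc a) k) ≡ expCoeff rhs₁ a (suc b) c
    next = trans (cong (λ z → fromℕ (B N (suc a) (suc (suc z)))) (sym (+-suc a b)))
                 (upperB M upA a (suc b) c (cong (λ z → 3 + (z + c)) (+-suc a b)))

  lowerB : ∀ M → 3 ≤ M → UpperB (suc M) → LowerA M → LowerB (suc M)
  lowerB M 3≤M upB lowA a zero c refl = trans
    (cong fromℕ (B[1+k,k]≡B[k,1+k] (suc (a + 0 + c)) (suc c) (≤-pred 3≤M) (s≤s z≤n) (s≤s (m≤n+m c (a + 0)))))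
    (trans (cong (λ z → fromℕ (B N (suc c) (suc (suc z)))) (sym (+-identityʳ c)))
      (trans (upB c 0 a (cong (3 +_) (a+0+c≡c+0+a c a))) (sym (expCoeff-rhs₂-mirror c a))))
    where N = 3 + (a + 0 + c)
  lowerB M 3≤M upB lowA a (suc b) c refl = trans
    (cong fromℕ (ts4-3 N m k (3≤3+ _) (s≤s (s≤s z≤n)) (s≤s (s≤s (m≤n+m c b))) m≤N-2))
    (trans (fromℕ-+ (B N m k) (A (N ∸ 1) m k))
      (trans (cong₂ Q._+_ (lowerB M 3≤M upB lowA (suc a) b c (cong (λ z → 3 + (z + c)) (sym (+-suc a b))))
                          (lowA a b c (cong (λ z → 2 + (z + c)) (sym (+-suc a b)))))
             (sym (expCoeff-step-y rhs₂ companion₂ ∂y-rhs₂ a b c))))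
    where
    N = 3 + (a + suc b + c)
    m = 2 + (b + c)
    k = suc c
    m≤N-2 : m ≤ N ∸ 2
    m≤N-2 = s≤s (subst (suc (b + c) ≤_) (cong (_+ c) (sym (+-suc a b))) (s≤s (+-monoˡ-≤ c (m≤n+m b a))))

  lastRowB : ∀ M → 3 ≤ M → LowerB (suc M) → LastRowB (suc M)
  lastRowB M 3≤M lowB zero zero 2≡1+M with subst (3 ≤_) (sym (cong pred 2≡1+M)) 3≤M
  ... | s≤s ()
  lastRowB M 3≤M lowB (suc b) zero refl = trans (cong fromℕ (ts2-b1 (2 + (suc b + 0)) (3≤3+ _))) (sym (expCoeff-companion₂-y-axis b))
  lastRowB M 3≤M lowB b (suc c) refl = trans
    (cong fromℕ (trans (ts4-1 N (suc (suc c)) 3≤N (s≤s (s≤s z≤n)) (s≤s (m≤n+m (suc c) b)))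
                       (sym (ts4-2 N (suc c) 3≤N (s≤s z≤n) (m≤n+m (suc c) b)))))
    (trans (cong (λ z → fromℕ (B N (suc z) (suc c))) (+-suc b c))
      (trans (lowB 0 b c (cong (λ z → suc (suc z)) (sym (+-suc b c)))) (sym (expCoeff-companion₂-x⁰ b c))))
    where
    N = 2 + (b + suc c)
    3≤N : 3 ≤ N
    3≤N = ≤-trans 3≤M (n≤1+n _)

  EvenSize : ℕ → Set
  EvenSize N = UpperB N × LowerB N × LastRowB N

  evenSize-step : ∀ M → 2 ≤ M → EvenSize M → EvenSize (2 + M)
  evenSize-step M 2≤M (upB , lowB , lastB) = upB′ , lowB′ , lastRowB (suc M) (s≤s 2≤M) lowB′
    where
    lowA = lowerA M lastB lowB
    upB′ = upperB (suc M) (upperA M upB lowA)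
    lowB′ = lowerB (suc M) (s≤s 2≤M) upB′ lowA

  evenSize : ∀ n → EvenSize (2 + (n + n))
  evenSize zero = (λ _ _ _ ()) , (λ _ _ _ ()) , λ { zero zero refl → trans (cong fromℕ ts3-b21) (sym expCoeff-companion₂-origin) }
  evenSize (suc n) = subst EvenSize (cong (2 +_) (sym (+-suc (suc n) n))) (evenSize-step (2 + (n + n)) (s≤s (s≤s z≤n)) (evenSize n))

  half : ∀ m → isEven m ≡ true → Σ[ k ∈ ℕ ] k + k ≡ m
  half zero          _ = 0 , refl
  half (suc zero)    ()
  half (suc (suc m)) e with half m e
  ... | k , k+k≡m = suc k , cong suc (trans (+-suc k k) (cong suc k+k≡m))

  even⇒evenSize : ∀ N → isEven N ≡ true → 3 ≤ N → Σ[ n ∈ ℕ ] 2 + (n + n) ≡ N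
  even⇒evenSize N e 3≤N with half N e
  ... | suc n , 1+n+1+n≡N = n , trans (cong suc (sym (+-suc n n))) 1+n+1+n≡N
  ... | zero  , refl with 3≤N
  ...   | ()

  isEven[x+3]≡false⇒isEven[x] : ∀ x → isEven (x + 3) ≡ false → isEven x ≡ true
  isEven[x+3]≡false⇒isEven[x] x e = not-injective (trans (sym (p⇔ᵇfalse (isEven x))) (trans (sym (isEven-+ x 3)) e))
    where
    p⇔ᵇfalse : ∀ p → p ⇔ᵇ false ≡ not p
    p⇔ᵇfalse true  = refl
    p⇔ᵇfalse false = refl

  coeff-from-entries : ∀ F (entry : ℕ → ℕ → ℕ → ℕ) → Supported₃ false F →
    (∀ n a b c → 2 + (n + n) ≡ a + b + c + 3 → fromℕ (entry a b c) ≡ expCoeff F a b c) → ∀ a b c →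
    (if isEven (a + b + c + 3) then fromℕ (entry a b c) Q.* (invFact a Q.* invFact b Q.* invFact c) else Q.0ℚ) ≡ F a b c
  coeff-from-entries F entry odd fromEntries a b c with isEven (a + b + c + 3) in e
  ... | false = sym (odd a b c (isEven[x+3]≡false⇒isEven[x] (a + b + c) e))
  ... | true with even⇒evenSize (a + b + c + 3) e (subst (3 ≤_) (+-comm 3 (a + b + c)) (3≤3+ _))
  ... | n , size≡ = trans (cong (Q._* (invFact a Q.* invFact b Q.* invFact c)) (fromEntries n a b c size≡))
                          (expCoeff*invFacts≡coeff F a b c)

  lhs₁≈₃rhs₁ : lhs₁ B ≈₃ rhs₁
  lhs₁≈₃rhs₁ = coeff-from-entries rhs₁ (λ a b c → B (a + b + c + 3) (a + 1) (a + b + 2)) rhs₁-supported upper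
    where
    upper : ∀ n a b c → 2 + (n + n) ≡ a + b + c + 3 → fromℕ (B (a + b + c + 3) (a + 1) (a + b + 2)) ≡ expCoeff rhs₁ a b c
    upper n a b c size≡ rewrite sym size≡ | +-comm a 1 | +-comm (a + b) 2 =
      proj₁ (evenSize n) a b c (trans (+-comm 3 (a + b + c)) (sym size≡))

  lhs₂≈₃rhs₂ : lhs₂ B ≈₃ rhs₂
  lhs₂≈₃rhs₂ = coeff-from-entries rhs₂ (λ a b c → B (a + b + c + 3) (b + c + 2) (c + 1)) rhs₂-supported lower
    where
    lower : ∀ n a b c → 2 + (n + n) ≡ a + b + c + 3 → fromℕ (B (a + b + c + 3) (b + c + 2) (c + 1)) ≡ expCoeff rhs₂ a b c
    lower n a b c size≡ rewrite sym size≡ | +-comm (b + c) 2 | +-comm c 1 =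
      proj₁ (proj₂ (evenSize n)) a b c (trans (+-comm 3 (a + b + c)) (sym size≡))


theorem1p5 : (A B : MatSeq) → TwinSeidel A B →
             (lhs₁ B ≈₃ rhs₁) × (lhs₂ B ≈₃ rhs₂)
theorem1p5 A B ts = lhs₁≈₃rhs₁ , lhs₂≈₃rhs₂
  where open EntriesAsCoefficients ts
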